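{- Let $n\ge 5$, let $A$ be an apartment of the spherical building $\Delta=|\Lambda(\mathbb{F}_2^{n-1})|$ and let $p$ be a vertex of $A$. If the link $\operatorname{lk}(p,A)$ is contained in $|\mathrm{NCP}_n|$, then $p$ is a vertex of $|\mathrm{NCP}_n|$. Moreover, this statement is false for $n=4$.
   Context: $\Delta$ is the order complex of the lattice of linear subspaces of $\mathbb{F}_2^{n-1}$: vertices are the proper non-zero subspaces and simplices are chains. An apartment of $\Delta$ is, for a basis $v_1,\ldots,v_{n-1}$, the subcomplex of all chains of subspaces spanned by proper non-empty subsets of the basis. $\operatorname{lk}(p,A)$ is the set of simplices $\sigma\in A$ with $p\notin\sigma$ and $\sigma\cup\{p\}\in A$. Let $e_1,\ldots,e_{n-1}$ be the standard basis, $e_n:=0$; for a set partition $\pi$ of $\{1,\ldots,n\}$ let $f(\pi)=\operatorname{span}\{e_i+e_j: i,j\text{ in a common block}\}$. A partition is non-crossing if no $a<b<c<d$ have $a,c$ in one block and $b,d$ in another block. $|\mathrm{NCP}_n|$ is the subcomplex of $\Delta$ of chains of proper non-zero subspaces $f(\pi)$ with $\pi$ non-crossing. -}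

module Defs where

open import Data.Bool using (Bool; true; false; _xor_; if_then_else_)
open import Data.Nat using (ℕ; zero; suc; pred)
open import Data.Nat.Properties using (_≟_)
open import Data.Fin using (Fin; toℕ) renaming (_<_ to _<ᶠ_)
open import Data.Vec using (Vec; replicate; zipWith; tabulate)
open import Data.List using (List; _∷_)
open import Data.List.Relation.Unary.All using (All)
open import Data.List.Relation.Unary.Any using (Any)
open import Data.List.Membership.Propositional using (_∈_)
open import Data.Product using (Σ; ∃; ∃-syntax; _×_)
open import Data.Sum using (_⊎_)
open import Relation.Nullary using (¬_; ⌊_⌋)
open import Relation.Binary.PropositionalEquality using (_≡_; _≢_)
open import Level using (Level; _⊔_) renaming (suc to lsuc)

Vect : ℕ → Set
Vect k = Vec Bool k

0ᵥ : ∀ {k} → Vect k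
0ᵥ = replicate _ false

infixl 6 _⊕_
_⊕_ : ∀ {k} → Vect k → Vect k → Vect k
_⊕_ = zipWith _xor_

SubsetV : ℕ → Set₁
SubsetV k = Vect k → Set

_⊆ᵥ_ : ∀ {k} → SubsetV k → SubsetV k → Set
P ⊆ᵥ Q = ∀ w → P w → Q w

_≐_ : ∀ {k} → SubsetV k → SubsetV k → Set
P ≐ Q = (P ⊆ᵥ Q) × (Q ⊆ᵥ P)

data Span {k : ℕ} (G : SubsetV k) : Vect k → Set where
  span-0   : Span G 0ᵥ
  span-add : ∀ {g w} → G g → Span G w → Span G (g ⊕ w)

ProperNonZero : ∀ {k} → SubsetV k → Set
ProperNonZero {k} P = (∃[ w ] (P w × w ≢ 0ᵥ)) × (∃[ w ] ¬ P w)

lincomb : ∀ {k j} → (Fin j → Bool) → (Fin j → Vect k) → Vect k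
lincomb {j = zero}  c v = 0ᵥ
lincomb {j = suc j} c v =
  (if c Fin.zero then v Fin.zero else 0ᵥ) ⊕ lincomb (λ i → c (Fin.suc i)) (λ i → v (Fin.suc i))

LinIndep : ∀ {k j} → (Fin j → Vect k) → Set
LinIndep {j = j} v = (c : Fin j → Bool) → lincomb c v ≡ 0ᵥ → ∀ i → c i ≡ false

Spanning : ∀ {k j} → (Fin j → Vect k) → Set
Spanning {k} v = (w : Vect k) → Span (λ u → ∃[ i ] (u ≡ v i)) w

IsBasis : ∀ {k} → (Fin k → Vect k) → Set
IsBasis v = LinIndep v × Spanning v

-- Simplices of the order complex Δ: finite sets (lists) of vertices forming a chain.

Chain : ∀ {k} → List (SubsetV k) → Set₁
Chain σ = ∀ {P Q} → P ∈ σ → Q ∈ σ → (P ⊆ᵥ Q) ⊎ (Q ⊆ᵥ P)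

spanOf : ∀ {k} → (Fin k → Vect k) → (Fin k → Bool) → SubsetV k
spanOf v S = Span (λ u → ∃[ i ] (S i ≡ true × u ≡ v i))

ProperNonEmpty : ∀ {k} → (Fin k → Bool) → Set
ProperNonEmpty S = (∃[ i ] S i ≡ true) × (∃[ i ] S i ≡ false)

VertexA : ∀ {k} → (Fin k → Vect k) → SubsetV k → Set
VertexA v P = ∃[ S ] (ProperNonEmpty S × P ≐ spanOf v S)

SimplexA : ∀ {k} → (Fin k → Vect k) → List (SubsetV k) → Set₁
SimplexA v σ = All (VertexA v) σ × Chain σ

InLink : ∀ {k} → (Fin k → Vect k) → SubsetV k → List (SubsetV k) → Set₁
InLink v p σ = SimplexA v σ × ¬ Any (λ Q → Q ≐ p) σ × SimplexA v (p ∷ σ)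

-- A set partition is given by a block-labelling: i, j in a common block iff π i ≡ π j.
Partition : ℕ → Set
Partition n = Fin n → Fin n

NonCrossing : ∀ {n} → Partition n → Set
NonCrossing π = ∀ a b c d → a <ᶠ b → b <ᶠ c → c <ᶠ d →
  π a ≡ π c → π b ≡ π d → π a ≡ π b

-- e_i ∈ F₂^{n-1} for i ∈ {1,…,n} (Fin n, index i ↔ e_{i+1});
-- the last index gives toℕ i = n-1, which matches no coordinate, so e_n = 0.
e : ∀ {n} → Fin n → Vect (pred n)
e i = tabulate (λ j → ⌊ toℕ i ≟ toℕ j ⌋)

f : ∀ {n} → Partition n → SubsetV (pred n)
f π = Span (λ u → ∃[ i ] ∃[ j ] (π i ≡ π j × u ≡ e i ⊕ e j))

VertexNCP : (n : ℕ) → SubsetV (pred n) → Set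
VertexNCP n P = ProperNonZero P × ∃[ π ] (NonCrossing {n} π × P ≐ f π)

SimplexNCP : (n : ℕ) → List (SubsetV (pred n)) → Set₁
SimplexNCP n σ = All (VertexNCP n) σ × Chain σ

LinkInNCP : (n : ℕ) → (Fin (pred n) → Vect (pred n)) → SubsetV (pred n) → Set₁
LinkInNCP n v p = (σ : List (SubsetV (pred n))) → InLink v p σ → SimplexNCP n σ

-- Let p = span{v_s : s ∈ S}. Call two of the n points linked when e_a + e_b ∈ p; the classes of
-- this equivalence form a partition π with f(π) ⊆ p. Each vertex span{v_t : t ∈ T} with T ⊊ S or
-- T ⊋ S lies in the link, hence equals f(ρ) for a noncrossing ρ. Applying this to suitable T shows
-- that every v_s (s ∈ S) is an edge e_a + e_b, so that p = f(π), and that linking is noncrossing: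
-- a crossing a – c, b – d would survive in f(ρ) for some T, forcing e_a + e_b into p. For S = {s}
-- the first step is the subtle one: for each t ∉ S the plane spanned by v_s and v_t is some f(ρ_t),
-- so v_s is an edge or a sum e_i + e_j + e_k + e_l whose pairs {v_t, v_s + v_t} are noncrossing and
-- distinct for distinct t; three such t (here n ≥ 5 is needed) would make all three matchings of
-- {i, j, k, l} noncrossing, but one of them always crosses. For n = 4 the span of e₁ + e₃ and
-- e₂ + e₄ is a vertex of the apartment of e₁ + e₃, e₂, e₁ whose link consists of noncrossing
-- lines, while the vertex itself is crossing.

module Submission where

open import Defs
open import Algebra.Bundles using (CommutativeRing)
open import Data.Bool using (Bool; true; false; _xor_; if_then_else_; not; _∧_; _∨_)
open import Data.Bool.Properties
  using (xor-assoc; xor-comm; xor-same; xor-identityˡ; xor-identityʳ; xor-annihilates-not;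
         not-injective; not-involutive; not-distribʳ-xor; ¬-not;
         ∧-distribˡ-xor; ∧-identityʳ; ∧-zeroʳ; ∨-zeroʳ; ∨-comm; xor-∧-commutativeRing)
  renaming (_≟_ to _≟ᵇ_)
open import Data.Nat using (ℕ; zero; suc; _+_; _≤_; pred; s≤s; z≤n)
import Data.Nat.Properties as ℕ
open import Data.Fin using (Fin; toℕ) renaming (zero to fz; suc to fs; _<_ to _<ᶠ_)
open import Data.Fin.Properties using (any?; all?; <-cmp; <-trans; <-asym; <⇒≢)
  renaming (_≟_ to _≟ᶠ_; _<?_ to _<?ᶠ_)
open import Data.Vec using ([]; _∷_; tabulate)
open import Data.Vec.Properties
  using (zipWith-comm; zipWith-assoc; zipWith-identityˡ; zipWith-identityʳ; tabulate-cong; ≡-dec)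
open import Data.List using ([]; _∷_)
open import Data.List.Relation.Unary.All using ([]; _∷_)
import Data.List.Relation.Unary.All as All
open import Data.List.Relation.Unary.Any using (Any; here; there)
import Data.List.Relation.Unary.Any as Any
open import Data.Product using (∃-syntax; _×_; _,_; proj₁; proj₂)
open import Data.Sum using (_⊎_; inj₁; inj₂; [_,_]; swap)
open import Data.Empty using (⊥; ⊥-elim)
open import Relation.Binary using (tri<; tri≈; tri>)
open import Relation.Nullary using (¬_; ¬?; Dec; yes; no; does; ⌊_⌋)
open import Relation.Nullary.Decidable using (_→-dec_; _×-dec_; toWitness; dec-true; dec-false; decidable-stable)
open import Relation.Binary.PropositionalEquality hiding ([_])
open ≡-Reasoning

open import Algebra.Properties.CommutativeSemigroup
  (CommutativeRing.+-commutativeSemigroup xor-∧-commutativeRing)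
  using () renaming (interchange to xor-interchange)

false≢true : false ≢ true
false≢true ()

xor≡false⇒≡ : ∀ {x y} → x xor y ≡ false → x ≡ y
xor≡false⇒≡ {false} {false} _ = refl
xor≡false⇒≡ {true}  {true}  _ = refl

∧≡true⇒ : ∀ {x y} → x ∧ y ≡ true → x ≡ true × y ≡ true
∧≡true⇒ {true} {true} _ = refl , refl

∨≡true⇒ : ∀ {x y} → x ∨ y ≡ true → x ≡ true ⊎ y ≡ true
∨≡true⇒ {true}  _ = inj₁ refl
∨≡true⇒ {false} h = inj₂ h

∧-not-split : ∀ x b → x ≡ (x ∧ not b) xor (x ∧ b)
∧-not-split false b     = refl
∧-not-split true  false = refl
∧-not-split true  true  = refl

does-sound : ∀ {A : Set} (a? : Dec A) → does a? ≡ true → A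
does-sound (yes a) _ = a

⊕-comm : ∀ {k} (x y : Vect k) → x ⊕ y ≡ y ⊕ x
⊕-comm = zipWith-comm xor-comm

⊕-assoc : ∀ {k} (x y z : Vect k) → x ⊕ y ⊕ z ≡ x ⊕ (y ⊕ z)
⊕-assoc = zipWith-assoc xor-assoc

⊕-identityˡ : ∀ {k} (x : Vect k) → 0ᵥ ⊕ x ≡ x
⊕-identityˡ = zipWith-identityˡ xor-identityˡ

⊕-identityʳ : ∀ {k} (x : Vect k) → x ⊕ 0ᵥ ≡ x
⊕-identityʳ = zipWith-identityʳ xor-identityʳ

⊕-self : ∀ {k} (x : Vect k) → x ⊕ x ≡ 0ᵥ
⊕-self []      = refl
⊕-self (a ∷ x) = cong₂ _∷_ (xor-same a) (⊕-self x)

⊕-interchange : ∀ {k} (a b c d : Vect k) → (a ⊕ b) ⊕ (c ⊕ d) ≡ (a ⊕ c) ⊕ (b ⊕ d)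
⊕-interchange []      []      []      []      = refl
⊕-interchange (a ∷ x) (b ∷ y) (c ∷ z) (d ∷ w) =
  cong₂ _∷_ (xor-interchange a b c d) (⊕-interchange x y z w)

⊕-telescope : ∀ {k} (x y z : Vect k) → (x ⊕ y) ⊕ (y ⊕ z) ≡ x ⊕ z
⊕-telescope x y z = begin
  (x ⊕ y) ⊕ (y ⊕ z)  ≡⟨ cong (_⊕ (y ⊕ z)) (⊕-comm x y) ⟩
  (y ⊕ x) ⊕ (y ⊕ z)  ≡⟨ ⊕-interchange y x y z ⟩
  (y ⊕ y) ⊕ (x ⊕ z)  ≡⟨ cong (_⊕ (x ⊕ z)) (⊕-self y) ⟩
  0ᵥ ⊕ (x ⊕ z)       ≡⟨ ⊕-identityˡ (x ⊕ z) ⟩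
  x ⊕ z              ∎

x⊕y⊕y≡x : ∀ {k} (x y : Vect k) → x ⊕ y ⊕ y ≡ x
x⊕y⊕y≡x x y = begin
  x ⊕ y ⊕ y    ≡⟨ ⊕-assoc x y y ⟩
  x ⊕ (y ⊕ y)  ≡⟨ cong (x ⊕_) (⊕-self y) ⟩
  x ⊕ 0ᵥ       ≡⟨ ⊕-identityʳ x ⟩
  x            ∎

x⊕y⊕x≡y : ∀ {k} (x y : Vect k) → x ⊕ y ⊕ x ≡ y
x⊕y⊕x≡y x y = trans (cong (_⊕ x) (⊕-comm x y)) (x⊕y⊕y≡x y x)

x≡y⊕[x⊕y] : ∀ {k} (x y : Vect k) → x ≡ y ⊕ (x ⊕ y)
x≡y⊕[x⊕y] x y = sym (trans (⊕-comm y (x ⊕ y)) (x⊕y⊕y≡x x y))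

⊕-cancelˡ : ∀ {k} {x y z : Vect k} → x ⊕ y ≡ x ⊕ z → y ≡ z
⊕-cancelˡ {x = x} {y} {z} h = begin
  y            ≡⟨ sym (x⊕y⊕x≡y x y) ⟩
  x ⊕ y ⊕ x    ≡⟨ cong (_⊕ x) h ⟩
  x ⊕ z ⊕ x    ≡⟨ x⊕y⊕x≡y x z ⟩
  z            ∎

_≟ᵥ_ : ∀ {k} (x y : Vect k) → Dec (x ≡ y)
_≟ᵥ_ = ≡-dec _≟ᵇ_

record IsSubspace {k} (Q : SubsetV k) : Set where
  field
    0∈  : Q 0ᵥ
    ⊕∈  : ∀ {x y} → Q x → Q y → Q (x ⊕ y)

open IsSubspace

span-isSubspace : ∀ {k} (G : SubsetV k) → IsSubspace (Span G)
span-isSubspace G = record { 0∈ = span-0 ; ⊕∈ = span-⊕ }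
  where
  span-⊕ : ∀ {x y} → Span G x → Span G y → Span G (x ⊕ y)
  span-⊕ {y = y} span-0 sy = subst (Span G) (sym (⊕-identityˡ y)) sy
  span-⊕ {y = y} (span-add {g} {w} h sx) sy =
    subst (Span G) (sym (⊕-assoc g w y)) (span-add h (span-⊕ sx sy))

span-gen : ∀ {k} {G : SubsetV k} {g} → G g → Span G g
span-gen {g = g} h = subst (Span _) (⊕-identityʳ g) (span-add h span-0)

span-least : ∀ {k} {G Q : SubsetV k} → IsSubspace Q → G ⊆ᵥ Q → Span G ⊆ᵥ Q
span-least Q G⊆Q _ span-0           = 0∈ Q
span-least Q G⊆Q _ (span-add g∈ s) = ⊕∈ Q (G⊆Q _ g∈) (span-least Q G⊆Q _ s)

span-mono : ∀ {k} {G H : SubsetV k} → G ⊆ᵥ H → Span G ⊆ᵥ Span H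
span-mono G⊆H = span-least (span-isSubspace _) (λ g h → span-gen (G⊆H g h))

generator-∉ : ∀ {k} {G Q : SubsetV k} → IsSubspace Q → (∀ w → Dec (Q w)) →
  ∀ {w} → Span G w → ¬ Q w → ∃[ g ] (G g × ¬ Q g)
generator-∉ Q Q? span-0 w∉ = ⊥-elim (w∉ (0∈ Q))
generator-∉ Q Q? (span-add {g} g∈ s) w∉ with Q? g
... | no  g∉ = g , g∈ , g∉
... | yes g∈Q = generator-∉ Q Q? s (λ w∈ → w∉ (⊕∈ Q g∈Q w∈))

Linear : ∀ {k} → (Vect k → Bool) → Set
Linear φ = ∀ x y → φ (x ⊕ y) ≡ φ x xor φ y

kernel-isSubspace : ∀ {k} {φ : Vect k → Bool} → Linear φ → IsSubspace (λ w → φ w ≡ false)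
kernel-isSubspace {φ = φ} lin = record
  { 0∈ = trans (cong φ (sym (⊕-self 0ᵥ))) (trans (lin 0ᵥ 0ᵥ) (xor-same (φ 0ᵥ)))
  ; ⊕∈ = λ {x} {y} φx φy → trans (lin x y) (cong₂ _xor_ φx φy)
  }

Pair : ∀ {k} → Vect k → SubsetV k
Pair x w = (w ≡ 0ᵥ) ⊎ (w ≡ x)

pair-isSubspace : ∀ {k} (x : Vect k) → IsSubspace (Pair x)
pair-isSubspace x = record { 0∈ = inj₁ refl ; ⊕∈ = closed }
  where
  closed : ∀ {a b} → Pair x a → Pair x b → Pair x (a ⊕ b)
  closed (inj₁ refl) q           = subst (Pair x) (sym (⊕-identityˡ _)) q
  closed (inj₂ refl) (inj₁ refl) = inj₂ (⊕-identityʳ x)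
  closed (inj₂ refl) (inj₂ refl) = inj₁ (⊕-self x)

pair? : ∀ {k} (x : Vect k) → ∀ w → Dec (Pair x w)
pair? x w with w ≟ᵥ 0ᵥ | w ≟ᵥ x
... | yes w≡0 | _      = yes (inj₁ w≡0)
... | no  _   | yes w≡x = yes (inj₂ w≡x)
... | no  w≢0 | no w≢x = no λ { (inj₁ z) → w≢0 z ; (inj₂ z) → w≢x z }

δ : ∀ {j} → Fin j → Fin j → Bool
δ i j = does (i ≟ᶠ j)

δ-refl : ∀ {n} (a : Fin n) → δ a a ≡ true
δ-refl a = dec-true (a ≟ᶠ a) refl

δ-true : ∀ {n} {a b : Fin n} → δ a b ≡ true → a ≡ b
δ-true {a = a} {b} = does-sound (a ≟ᶠ b)

δ-false : ∀ {n} {a b : Fin n} → a ≢ b → δ a b ≡ false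
δ-false {a = a} {b} = dec-false (a ≟ᶠ b)

δ-suc : ∀ {n} (i j : Fin n) → δ (fs i) (fs j) ≡ δ i j
δ-suc i j with i ≟ᶠ j
... | yes _ = refl
... | no  _ = refl

infix 4 _⊆ᵇ_

_⊆ᵇ_ : ∀ {k} → (Fin k → Bool) → (Fin k → Bool) → Set
c ⊆ᵇ S = ∀ i → c i ≡ true → S i ≡ true

lincomb-cong : ∀ {k j} {c d : Fin j → Bool} (v : Fin j → Vect k) →
  (∀ i → c i ≡ d i) → lincomb c v ≡ lincomb d v
lincomb-cong {j = zero}  v c≗d = refl
lincomb-cong {j = suc j} v c≗d rewrite c≗d fz =
  cong (_ ⊕_) (lincomb-cong (λ i → v (fs i)) (λ i → c≗d (fs i)))

lincomb-false : ∀ {k j} (v : Fin j → Vect k) → lincomb (λ _ → false) v ≡ 0ᵥ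
lincomb-false {j = zero}  v = refl
lincomb-false {j = suc j} v = trans (⊕-identityˡ _) (lincomb-false (λ i → v (fs i)))

lincomb-nonzero : ∀ {k j} (c : Fin j → Bool) (v : Fin j → Vect k) → lincomb c v ≢ 0ᵥ → ∃[ i ] c i ≡ true
lincomb-nonzero c v ≢0 with any? (λ i → c i ≟ᵇ true)
... | yes found = found
... | no  none  = ⊥-elim (≢0 (trans (lincomb-cong v (λ i → ¬-not (λ ci → none (i , ci)))) (lincomb-false v)))

sel : ∀ {k} → Bool → Vect k → Vect k
sel b x = if b then x else 0ᵥ

sel-xor : ∀ {k} a b (x : Vect k) → sel (a xor b) x ≡ sel a x ⊕ sel b x
sel-xor false false x = sym (⊕-identityˡ 0ᵥ)
sel-xor false true  x = sym (⊕-identityˡ x)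
sel-xor true  false x = sym (⊕-identityʳ x)
sel-xor true  true  x = sym (⊕-self x)

lincomb-xor : ∀ {k j} (c d : Fin j → Bool) (v : Fin j → Vect k) →
  lincomb (λ i → c i xor d i) v ≡ lincomb c v ⊕ lincomb d v
lincomb-xor {j = zero}  c d v = sym (⊕-self 0ᵥ)
lincomb-xor {j = suc j} c d v =
  trans (cong₂ _⊕_ (sel-xor (c fz) (d fz) (v fz))
                   (lincomb-xor (λ i → c (fs i)) (λ i → d (fs i)) (λ i → v (fs i))))
        (⊕-interchange _ _ _ _)

lincomb-δ : ∀ {k j} (i : Fin j) (v : Fin j → Vect k) → lincomb (δ i) v ≡ v i
lincomb-δ {j = suc j} fz v =
  trans (cong (v fz ⊕_) (lincomb-false (λ i → v (fs i)))) (⊕-identityʳ _)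
lincomb-δ {j = suc j} (fs i) v = begin
  0ᵥ ⊕ lincomb (λ l → δ (fs i) (fs l)) (λ l → v (fs l)) ≡⟨ ⊕-identityˡ _ ⟩
  lincomb (λ l → δ (fs i) (fs l)) (λ l → v (fs l))      ≡⟨ lincomb-cong _ (δ-suc i) ⟩
  lincomb (δ i) (λ l → v (fs l))                        ≡⟨ lincomb-δ i (λ l → v (fs l)) ⟩
  v (fs i)                                              ∎

Generated : ∀ {k j} → (Fin j → Bool) → (Fin j → Vect k) → SubsetV k
Generated c v u = ∃[ i ] (c i ≡ true × u ≡ v i)

generated-suc : ∀ {k j} (c : Fin (suc j) → Bool) (v : Fin (suc j) → Vect k) →
  Generated (λ i → c (fs i)) (λ i → v (fs i)) ⊆ᵥ Generated c v
generated-suc c v _ (i , ci , u≡) = fs i , ci , u≡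

lincomb-span : ∀ {k j} (c : Fin j → Bool) (v : Fin j → Vect k) → Span (Generated c v) (lincomb c v)
lincomb-span {j = zero}  c v = span-0
lincomb-span {j = suc j} c v with c fz in c₀
... | true  = span-add (fz , c₀ , refl) (span-mono (generated-suc c v) _ (lincomb-span _ _))
... | false = subst (Span _) (sym (⊕-identityˡ _)) (span-mono (generated-suc c v) _ (lincomb-span _ _))

Rep : ∀ {k j} → (Fin j → Vect k) → (Fin j → Bool) → Vect k → Set
Rep v S w = ∃[ c ] (c ⊆ᵇ S × w ≡ lincomb c v)

span→rep : ∀ {k j} {v : Fin j → Vect k} {S} {w} → Span (Generated S v) w → Rep v S w
span→rep {v = v} span-0 = (λ _ → false) , (λ _ ()) , sym (lincomb-false v)
span→rep {v = v} {S} (span-add (i , Si , refl) s) with span→rep s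
... | c , c⊆S , refl =
  (λ l → δ i l xor c l) , coeff⊆S ,
  sym (trans (lincomb-xor (δ i) c v) (cong (_⊕ lincomb c v) (lincomb-δ i v)))
  where
  coeff⊆S : (λ l → δ i l xor c l) ⊆ᵇ S
  coeff⊆S l h with i ≟ᶠ l
  ... | yes refl = Si
  ... | no  _    = c⊆S l h

rep→span : ∀ {k j} {v : Fin j → Vect k} {S} {w} → Rep v S w → Span (Generated S v) w
rep→span {v = v} (c , c⊆S , refl) =
  span-mono (λ _ (i , ci , u≡) → i , c⊆S i ci , u≡) _ (lincomb-span c v)

spanOf-mono : ∀ {k} {v : Fin k → Vect k} {S T} → S ⊆ᵇ T → spanOf v S ⊆ᵥ spanOf v T
spanOf-mono S⊆T = span-mono (λ _ (i , Si , u≡) → i , S⊆T i Si , u≡)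

spanOf-isSubspace : ∀ {k} (v : Fin k → Vect k) S → IsSubspace (spanOf v S)
spanOf-isSubspace v S = span-isSubspace _

spanOf-δ : ∀ {k} (v : Fin k → Vect k) s → spanOf v (δ s) ⊆ᵥ Pair (v s)
spanOf-δ v s = span-least (pair-isSubspace (v s)) λ { _ (i , δsi , refl) → inj₂ (cong v (sym (δ-true δsi))) }

Plane : ∀ {k} → Vect k → Vect k → SubsetV k
Plane x y w = ∃[ a ] ∃[ b ] (w ≡ sel a x ⊕ sel b y)

plane-isSubspace : ∀ {k} (x y : Vect k) → IsSubspace (Plane x y)
plane-isSubspace x y = record { 0∈ = false , false , sym (⊕-self 0ᵥ) ; ⊕∈ = closed }
  where
  closed : ∀ {u w} → Plane x y u → Plane x y w → Plane x y (u ⊕ w)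
  closed (a , b , refl) (c , d , refl) = a xor c , b xor d , (begin
    (sel a x ⊕ sel b y) ⊕ (sel c x ⊕ sel d y)  ≡⟨ ⊕-interchange _ _ _ _ ⟩
    (sel a x ⊕ sel c x) ⊕ (sel b y ⊕ sel d y)  ≡⟨ sym (cong₂ _⊕_ (sel-xor a c x) (sel-xor b d y)) ⟩
    sel (a xor c) x ⊕ sel (b xor d) y          ∎)

spanOf-δ∨δ : ∀ {k} (v : Fin k → Vect k) s t → spanOf v (λ i → δ s i ∨ δ t i) ⊆ᵥ Plane (v s) (v t)
spanOf-δ∨δ v s t = span-least (plane-isSubspace (v s) (v t)) generator
  where
  generator : Generated (λ i → δ s i ∨ δ t i) v ⊆ᵥ Plane (v s) (v t)
  generator _ (i , h , refl) with s ≟ᶠ i | t ≟ᶠ i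
  ... | yes refl | _        = true , false , sym (⊕-identityʳ (v s))
  ... | no  _    | yes refl = false , true , sym (⊕-identityˡ (v t))

module Basis {k : ℕ} {v : Fin k → Vect k} (basis : IsBasis v) where

  coefficients-unique : ∀ c d → lincomb c v ≡ lincomb d v → ∀ i → c i ≡ d i
  coefficients-unique c d c≡d i = xor≡false⇒≡ (proj₁ basis (λ l → c l xor d l) sum≡0 i)
    where
    sum≡0 : lincomb (λ l → c l xor d l) v ≡ 0ᵥ
    sum≡0 = trans (lincomb-xor c d v) (trans (cong (_⊕ lincomb d v) c≡d) (⊕-self _))

  rep-unique : ∀ {S T w} (r : Rep v S w) (r′ : Rep v T w) → ∀ i → proj₁ r i ≡ proj₁ r′ i
  rep-unique (c , _ , w≡c) (d , _ , w≡d) = coefficients-unique c d (trans (sym w≡c) w≡d)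

  rep-all : ∀ w → Rep v (λ _ → true) w
  rep-all w = span→rep (span-mono (λ _ (i , u≡) → i , refl , u≡) _ (proj₂ basis w))

  v∈spanOf : ∀ {S} i → S i ≡ true → spanOf v S (v i)
  v∈spanOf i Si = span-gen (i , Si , refl)

  v∉spanOf : ∀ {S} i → S i ≡ false → ¬ spanOf v S (v i)
  v∉spanOf {S} i Si s with span→rep s
  ... | r@(c , c⊆S , _) with c⊆S i (trans (rep-unique r (δ i , (λ _ h → h) , sym (lincomb-δ i v)) i) (δ-refl i))
  ... | Si′ = false≢true (trans (sym Si) Si′)

  spanOf? : ∀ S w → Dec (spanOf v S w)
  spanOf? S w with rep-all w
  ... | r@(c , _ , w≡) with all? (λ i → (c i ≟ᵇ true) →-dec (S i ≟ᵇ true))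
  ... | yes c⊆S = yes (rep→span (c , c⊆S , w≡))
  ... | no  c⊈S = no λ s → c⊈S λ i ci →
          proj₁ (proj₂ (span→rep s)) i (trans (sym (rep-unique r (span→rep s) i)) ci)

  spanOf-⊈ : ∀ {S T} i → S i ≡ true → T i ≡ false → ¬ (spanOf v S ⊆ᵥ spanOf v T)
  spanOf-⊈ i Si Ti S⊆T = v∉spanOf i Ti (S⊆T _ (v∈spanOf i Si))

  spanOf-∩ : ∀ {T U w} → spanOf v T w → spanOf v U w → spanOf v (λ i → T i ∧ U i) w
  spanOf-∩ {T} {U} w∈T w∈U with span→rep w∈T | span→rep w∈U
  ... | r@(c , c⊆T , w≡) | r′@(_ , c′⊆U , _) =
    rep→span (c , (λ i ci → cong₂ _∧_ (c⊆T i ci) (c′⊆U i (trans (sym (rep-unique r r′ i)) ci))) , w≡)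

  v≢0 : ∀ i → v i ≢ 0ᵥ
  v≢0 i vi≡0 = v∉spanOf {λ _ → false} i refl (subst (spanOf v _) (sym vi≡0) span-0)

  v-injective : ∀ {s t} → s ≢ t → v s ≢ v t
  v-injective {s} {t} s≢t vs≡vt =
    v∉spanOf {δ t} s (δ-false (λ t≡s → s≢t (sym t≡s))) (subst (spanOf v (δ t)) (sym vs≡vt) (v∈spanOf t (δ-refl t)))

  v⊕v≢v : ∀ {s a b} → a ≢ s → b ≢ s → v a ⊕ v b ≢ v s
  v⊕v≢v {s} {a} {b} a≢s b≢s va⊕vb≡vs =
    v∉spanOf {λ i → not (δ s i)} s (cong not (δ-refl s))
      (subst (spanOf v _) va⊕vb≡vs (span-isSubspace _ .⊕∈ (outside a≢s) (outside b≢s)))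
    where
    outside : ∀ {i} → i ≢ s → spanOf v (λ l → not (δ s l)) (v i)
    outside i≢s = v∈spanOf _ (cong not (δ-false (λ s≡i → i≢s (sym s≡i))))

-- F₂^m is identified with the even subsets of the n points: point i < m is in the subset of x
-- iff x has a 1 in coordinate i, and the last point (where e = 0) records the parity of x.
isLast : ∀ {m} → Fin (suc m) → Bool
isLast {zero}  fz     = true
isLast {suc m} fz     = false
isLast {suc m} (fs i) = isLast i

ev : ∀ {m} → Fin (suc m) → Vect m → Bool
ev {zero}  fz     []       = false
ev {suc m} fz     (x ∷ xs) = x
ev {suc m} (fs i) (x ∷ xs) = (isLast i ∧ x) xor ev i xs

ev-linear : ∀ {m} (i : Fin (suc m)) → Linear (ev i)
ev-linear {zero}  fz     []      []      = refl
ev-linear {suc m} fz     (a ∷ x) (b ∷ y) = refl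
ev-linear {suc m} (fs i) (a ∷ x) (b ∷ y) =
  trans (cong₂ _xor_ (∧-distribˡ-xor (isLast i) a b) (ev-linear i x y))
        (xor-interchange (isLast i ∧ a) (isLast i ∧ b) (ev i x) (ev i y))

ev-0 : ∀ {m} (i : Fin (suc m)) → ev i 0ᵥ ≡ false
ev-0 i = kernel-isSubspace {φ = ev i} (ev-linear i) .0∈

ev-ext : ∀ {m} (x y : Vect m) → (∀ i → ev i x ≡ ev i y) → x ≡ y
ev-ext {zero}  []      []      _ = refl
ev-ext {suc m} (a ∷ x) (b ∷ y) h with h fz
... | refl = cong (a ∷_) (ev-ext x y (λ i → xor-cancelˡ {isLast i ∧ a} (h (fs i))))
  where
  xor-cancelˡ : ∀ {c u w} → c xor u ≡ c xor w → u ≡ w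
  xor-cancelˡ {false} eq = eq
  xor-cancelˡ {true}  eq = not-injective eq

ev-lincomb-false : ∀ {m j} (i : Fin (suc m)) (c : Fin j → Bool) (v : Fin j → Vect m) →
  (∀ s → c s ≡ true → ev i (v s) ≡ false) → ev i (lincomb c v) ≡ false
ev-lincomb-false i c v h =
  span-least (kernel-isSubspace {φ = ev i} (ev-linear i)) (λ { _ (s , cs , refl) → h s cs }) _ (lincomb-span c v)

private
  E : ∀ {m} → Fin (suc m) → Vect m
  E {zero}  _      = []
  E {suc m} fz     = true ∷ 0ᵥ
  E {suc m} (fs j) = false ∷ E j

  e≡E : ∀ {m} (i : Fin (suc m)) → e {suc m} i ≡ E i
  e≡E {zero}  i      = refl
  e≡E {suc m} fz     = cong (true ∷_) (tabulate-false m)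
    where
    tabulate-false : ∀ m → tabulate {n = m} (λ _ → false) ≡ 0ᵥ
    tabulate-false zero    = refl
    tabulate-false (suc m) = cong (false ∷_) (tabulate-false m)
  e≡E {suc m} (fs i) = cong (false ∷_) (trans (tabulate-cong (λ j → does-≟-suc (toℕ i) (toℕ j))) (e≡E i))
    where
    does-≟-suc : ∀ a b → ⌊ suc a ℕ.≟ suc b ⌋ ≡ ⌊ a ℕ.≟ b ⌋
    does-≟-suc a b with a ℕ.≟ b | suc a ℕ.≟ suc b
    ... | yes _    | yes _   = refl
    ... | no  _    | no  _   = refl
    ... | yes refl | no sa≢sa = ⊥-elim (sa≢sa refl)
    ... | no  a≢b  | yes sa≡sb = ⊥-elim (a≢b (ℕ.suc-injective sa≡sb))

  ev-E : ∀ {m} (i j : Fin (suc m)) → ev i (E j) ≡ δ i j xor isLast i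
  ev-E {zero}  fz     fz     = refl
  ev-E {suc m} fz     fz     = refl
  ev-E {suc m} fz     (fs j) = refl
  ev-E {suc m} (fs i) fz     =
    trans (cong₂ _xor_ (∧-identityʳ (isLast i)) (ev-0 i)) (xor-comm (isLast i) false)
  ev-E {suc m} (fs i) (fs j) =
    trans (cong₂ _xor_ (∧-zeroʳ (isLast i)) (ev-E i j)) (cong (_xor isLast i) (sym (δ-suc i j)))

edge : ∀ {m} → Fin (suc m) → Fin (suc m) → Vect m
edge a b = e a ⊕ e b

ev-edge : ∀ {m} (i a b : Fin (suc m)) → ev i (edge a b) ≡ δ i a xor δ i b
ev-edge i a b rewrite e≡E a | e≡E b = begin
  ev i (E a ⊕ E b)                                ≡⟨ ev-linear i (E a) (E b) ⟩
  ev i (E a) xor ev i (E b)                       ≡⟨ cong₂ _xor_ (ev-E i a) (ev-E i b) ⟩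
  (δ i a xor isLast i) xor (δ i b xor isLast i)   ≡⟨ xor-interchange (δ i a) (isLast i) (δ i b) (isLast i) ⟩
  (δ i a xor δ i b) xor (isLast i xor isLast i)   ≡⟨ cong ((δ i a xor δ i b) xor_) (xor-same (isLast i)) ⟩
  (δ i a xor δ i b) xor false                     ≡⟨ xor-identityʳ _ ⟩
  δ i a xor δ i b                                 ∎

edge-self : ∀ {m} (a : Fin (suc m)) → edge a a ≡ 0ᵥ
edge-self a = ⊕-self (e a)

edge-sym : ∀ {m} (a b : Fin (suc m)) → edge a b ≡ edge b a
edge-sym a b = ⊕-comm (e a) (e b)

edge-trans : ∀ {m} (a b c : Fin (suc m)) → edge a b ⊕ edge b c ≡ edge a c
edge-trans a b c = ⊕-telescope (e a) (e b) (e c)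

ev-edge-endpoint : ∀ {m} {a b : Fin (suc m)} → a ≢ b → ev a (edge a b) ≡ true
ev-edge-endpoint {a = a} {b} a≢b = trans (ev-edge a a b) (cong₂ _xor_ (δ-refl a) (δ-false a≢b))

edge≡0⇒≡ : ∀ {m} {a b : Fin (suc m)} → edge a b ≡ 0ᵥ → a ≡ b
edge≡0⇒≡ {a = a} {b} ab≡0 with a ≟ᶠ b
... | yes a≡b = a≡b
... | no  a≢b with trans (sym (ev-edge-endpoint a≢b)) (trans (cong (ev a) ab≡0) (ev-0 a))
...   | ()

e-injective : ∀ {m} {a b : Fin (suc m)} → e {suc m} a ≡ e b → a ≡ b
e-injective {b = b} ea≡eb = edge≡0⇒≡ (trans (cong (_⊕ e b) ea≡eb) (⊕-self (e b)))

edge-injective : ∀ {m} {a b c d : Fin (suc m)} → edge a b ≡ edge c d → a ≢ b →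
  (a ≡ c × b ≡ d) ⊎ (a ≡ d × b ≡ c)
edge-injective {a = a} {b} {c} {d} ab≡cd a≢b
  with a ≟ᶠ c | a ≟ᶠ d | trans (sym (ev-edge-endpoint a≢b)) (trans (cong (ev a) ab≡cd) (ev-edge a c d))
... | yes refl | _        | _ = inj₁ (refl , e-injective (⊕-cancelˡ ab≡cd))
... | no  _    | yes refl | _ = inj₂ (refl , e-injective (⊕-cancelˡ (trans ab≡cd (edge-sym c a))))
... | no  _    | no  _    | ()

endpoint-outside : ∀ {m} {a c u w : Fin (suc m)} → u ≢ w → edge u w ≢ edge a c →
  (u ≢ a × u ≢ c) ⊎ (w ≢ a × w ≢ c)
endpoint-outside {a = a} {c} {u} {w} u≢w uw≢ac with u ≟ᶠ a | u ≟ᶠ c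
... | no u≢a  | no u≢c  = inj₁ (u≢a , u≢c)
... | yes refl | _      = inj₂ (≢-sym u≢w , λ w≡c → uw≢ac (cong (edge u) w≡c))
... | no _    | yes refl = inj₂ ((λ w≡a → uw≢ac (trans (cong (edge u) w≡a) (edge-sym u a))) , ≢-sym u≢w)

edge-interchange : ∀ {m} (i j k l : Fin (suc m)) → edge i k ⊕ edge j l ≡ edge i j ⊕ edge k l
edge-interchange i j k l = ⊕-interchange (e i) (e k) (e j) (e l)

edge-interchange′ : ∀ {m} (i j k l : Fin (suc m)) → edge i l ⊕ edge j k ≡ edge i j ⊕ edge k l
edge-interchange′ i j k l =
  trans (⊕-interchange (e i) (e l) (e j) (e k)) (cong (edge i j ⊕_) (edge-sym l k))

xsum : ∀ {n} → (Fin n → Bool) → Bool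
xsum {zero}  g = false
xsum {suc n} g = g fz xor xsum (λ i → g (fs i))

xsum-xor : ∀ {n} (g h : Fin n → Bool) → xsum (λ i → g i xor h i) ≡ xsum g xor xsum h
xsum-xor {zero}  g h = refl
xsum-xor {suc n} g h =
  trans (cong ((g fz xor h fz) xor_) (xsum-xor (λ i → g (fs i)) (λ i → h (fs i))))
        (xor-interchange (g fz) (h fz) _ _)

xsum-cong : ∀ {n} {g h : Fin n → Bool} → (∀ i → g i ≡ h i) → xsum g ≡ xsum h
xsum-cong {zero}  g≗h = refl
xsum-cong {suc n} g≗h = cong₂ _xor_ (g≗h fz) (xsum-cong (λ i → g≗h (fs i)))

xsum-false : ∀ n → xsum {n} (λ _ → false) ≡ false
xsum-false zero    = refl
xsum-false (suc n) = xsum-false n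

xsum-δ : ∀ {n} (g : Fin n → Bool) (a : Fin n) → xsum (λ l → g l ∧ δ l a) ≡ g a
xsum-δ {suc n} g fz = begin
  (g fz ∧ true) xor xsum (λ i → g (fs i) ∧ false)  ≡⟨ cong₂ _xor_ (∧-identityʳ (g fz)) (xsum-cong (λ i → ∧-zeroʳ (g (fs i)))) ⟩
  g fz xor xsum {n} (λ _ → false)                  ≡⟨ cong (g fz xor_) (xsum-false n) ⟩
  g fz xor false                                   ≡⟨ xor-identityʳ (g fz) ⟩
  g fz                                             ∎
xsum-δ {suc n} g (fs a) =
  trans (cong₂ _xor_ (∧-zeroʳ (g fz)) (xsum-cong (λ l → cong (g (fs l) ∧_) (δ-suc l a))))
        (xsum-δ (λ l → g (fs l)) a)

blockParity : ∀ {m} → Partition (suc m) → Fin (suc m) → Vect m → Bool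
blockParity π β x = xsum (λ l → δ (π l) β ∧ ev l x)

blockParity-linear : ∀ {m} (π : Partition (suc m)) β → Linear (blockParity π β)
blockParity-linear π β x y = trans
  (xsum-cong (λ l → trans (cong (δ (π l) β ∧_) (ev-linear l x y)) (∧-distribˡ-xor (δ (π l) β) (ev l x) (ev l y))))
  (xsum-xor (λ l → δ (π l) β ∧ ev l x) (λ l → δ (π l) β ∧ ev l y))

blockParity-edge : ∀ {m} (π : Partition (suc m)) β a b → blockParity π β (edge a b) ≡ δ (π a) β xor δ (π b) β
blockParity-edge π β a b = begin
  xsum (λ l → δ (π l) β ∧ ev l (edge a b))
    ≡⟨ xsum-cong (λ l → trans (cong (δ (π l) β ∧_) (ev-edge l a b)) (∧-distribˡ-xor (δ (π l) β) (δ l a) (δ l b))) ⟩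
  xsum (λ l → (δ (π l) β ∧ δ l a) xor (δ (π l) β ∧ δ l b))
    ≡⟨ xsum-xor (λ l → δ (π l) β ∧ δ l a) (λ l → δ (π l) β ∧ δ l b) ⟩
  xsum (λ l → δ (π l) β ∧ δ l a) xor xsum (λ l → δ (π l) β ∧ δ l b)
    ≡⟨ cong₂ _xor_ (xsum-δ (λ l → δ (π l) β) a) (xsum-δ (λ l → δ (π l) β) b) ⟩
  δ (π a) β xor δ (π b) β
    ∎

-- Every generator of f(π) meets every block an even number of times.
edge∈f⇒sameBlock : ∀ {m} (π : Partition (suc m)) a b → f π (edge a b) → π a ≡ π b
edge∈f⇒sameBlock π a b ab∈fπ = sym (δ-true (trans (sym (xor≡false⇒≡ parity)) (δ-refl (π a))))
  where
  evenOnGenerators : ∀ g → (∃[ i ] ∃[ j ] (π i ≡ π j × g ≡ edge i j)) → blockParity π (π a) g ≡ false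
  evenOnGenerators _ (i , j , πi≡πj , refl) = trans (blockParity-edge π (π a) i j)
    (trans (cong (λ z → δ z (π a) xor δ (π j) (π a)) πi≡πj) (xor-same (δ (π j) (π a))))
  parity : δ (π a) (π a) xor δ (π b) (π a) ≡ false
  parity = trans (sym (blockParity-edge π (π a) a b))
    (span-least (kernel-isSubspace (blockParity-linear π (π a))) evenOnGenerators _ ab∈fπ)

sameBlock⇒edge∈f : ∀ {m} (π : Partition (suc m)) a b → π a ≡ π b → f π (edge a b)
sameBlock⇒edge∈f π a b πa≡πb = span-gen (a , b , πa≡πb , refl)

-- The partition of the n points cut out by a subspace

first : ∀ {n} → (Fin (suc n) → Bool) → Fin (suc n)
first {zero}  g = fz
first {suc n} g = if g fz then fz else fs (first (λ j → g (fs j)))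

first-cong : ∀ {n} {g h : Fin (suc n) → Bool} → (∀ j → g j ≡ h j) → first g ≡ first h
first-cong {zero}  g≗h = refl
first-cong {suc n} {g} {h} g≗h rewrite g≗h fz with h fz
... | true  = refl
... | false = cong fs (first-cong (λ j → g≗h (fs j)))

first-true : ∀ {n} (g : Fin (suc n) → Bool) j → g j ≡ true → g (first g) ≡ true
first-true {zero}  g fz     gj = gj
first-true {suc n} g j      gj with g fz in g₀
... | true  = g₀
first-true {suc n} g fz     gj | false = ⊥-elim (false≢true (trans (sym g₀) gj))
first-true {suc n} g (fs j) gj | false = first-true (λ j → g (fs j)) j gj

module EdgeClasses {m : ℕ} {Q : SubsetV m} (Q-sub : IsSubspace Q) (Q? : ∀ w → Dec (Q w)) where

  Linked : Fin (suc m) → Fin (suc m) → Set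
  Linked a b = Q (edge a b)

  linked-refl : ∀ a → Linked a a
  linked-refl a = subst Q (sym (edge-self a)) (0∈ Q-sub)

  linked-sym : ∀ {a b} → Linked a b → Linked b a
  linked-sym {a} {b} = subst Q (edge-sym a b)

  linked-trans : ∀ {a b c} → Linked a b → Linked b c → Linked a c
  linked-trans {a} {b} {c} ab bc = subst Q (edge-trans a b c) (⊕∈ Q-sub ab bc)

  Linked? : ∀ a b → Dec (Linked a b)
  Linked? a b = Q? (edge a b)

  linked? : Fin (suc m) → Fin (suc m) → Bool
  linked? a b = does (Linked? a b)

  linked?-true : ∀ {a b} → Linked a b → linked? a b ≡ true
  linked?-true {a} {b} = dec-true (Linked? a b)

  linked?-sound : ∀ {a b} → linked? a b ≡ true → Linked a b
  linked?-sound {a} {b} = does-sound (Linked? a b)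

  classOf : Partition (suc m)
  classOf a = first (linked? a)

  linked-classOf : ∀ a → Linked a (classOf a)
  linked-classOf a = linked?-sound (first-true (linked? a) a (linked?-true (linked-refl a)))

  sameClass⇒linked : ∀ {a b} → classOf a ≡ classOf b → Linked a b
  sameClass⇒linked {a} {b} ca≡cb =
    linked-trans (linked-classOf a) (linked-sym (subst (Linked b) (sym ca≡cb) (linked-classOf b)))

  linked⇒sameClass : ∀ {a b} → Linked a b → classOf a ≡ classOf b
  linked⇒sameClass {a} {b} ab = first-cong λ j → bool-ext
    (λ aj → linked?-true (linked-trans (linked-sym ab) (linked?-sound aj)))
    (λ bj → linked?-true (linked-trans ab (linked?-sound bj)))
    where
    bool-ext : ∀ {x y : Bool} → (x ≡ true → y ≡ true) → (y ≡ true → x ≡ true) → x ≡ y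
    bool-ext {false} {false} _ _ = refl
    bool-ext {true}  {true}  _ _ = refl
    bool-ext {false} {true}  _ g = g refl
    bool-ext {true}  {false} f _ = sym (f refl)

  f-classOf⊆ : f classOf ⊆ᵥ Q
  f-classOf⊆ = span-least Q-sub λ { _ (i , j , ci≡cj , refl) → sameClass⇒linked ci≡cj }

  noncrossing-classOf : (∀ a b c d → a <ᶠ b → b <ᶠ c → c <ᶠ d → Linked a c → Linked b d → Linked a b) →
    NonCrossing classOf
  noncrossing-classOf nc a b c d a<b b<c c<d ac bd =
    linked⇒sameClass (nc a b c d a<b b<c c<d (sameClass⇒linked ac) (sameClass⇒linked bd))

  InClass : Fin (suc m) → Vect m → Set
  InClass a y = ∀ i → ¬ Linked a i → ev i y ≡ false

  OutOfClass : Fin (suc m) → Vect m → Set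
  OutOfClass a y = ∀ i → Linked a i → ev i y ≡ false

  inClass? : ∀ a y → Dec (InClass a y)
  inClass? a y = all? (λ i → ¬? (Linked? a i) →-dec (ev i y ≟ᵇ false))

  edge-inClass : ∀ {a x y} → Linked a x → Linked a y → InClass a (edge x y)
  edge-inClass {a} {x} {y} ax ay i ¬ai = trans (ev-edge i x y)
    (cong₂ _xor_ (δ-false (λ i≡x → ¬ai (subst (Linked a) (sym i≡x) ax)))
                 (δ-false (λ i≡y → ¬ai (subst (Linked a) (sym i≡y) ay))))

  linkedEdge-classes : ∀ a {x y} → Linked x y → InClass a (edge x y) ⊎ OutOfClass a (edge x y)
  linkedEdge-classes a {x} {y} xy with Linked? a x
  ... | yes ax = inj₁ (edge-inClass ax (linked-trans ax xy))
  ... | no ¬ax = inj₂ λ i ai → trans (ev-edge i x y)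
    (cong₂ _xor_ (δ-false (λ i≡x → ¬ax (subst (Linked a) i≡x ai)))
                 (δ-false (λ i≡y → ¬ax (linked-trans (subst (Linked a) i≡y ai) (linked-sym xy)))))

  inClass-endpoint : ∀ {a x y} → InClass a (edge x y) → x ≢ y → Linked a x
  inClass-endpoint {a} {x} {y} xy∈a x≢y with Linked? a x
  ... | yes ax = ax
  ... | no ¬ax = ⊥-elim (false≢true (trans (sym (xy∈a x ¬ax)) (ev-edge-endpoint x≢y)))

  inClass-disjoint : ∀ {a b y} → InClass a y → InClass b y → y ≢ 0ᵥ → Linked a b
  inClass-disjoint {a} {b} {y} y∈a y∈b y≢0 with any? (λ i → ev i y ≟ᵇ true)
  ... | yes (i , ev≡true) = linked-trans (linked-at y∈a ev≡true) (linked-sym (linked-at y∈b ev≡true))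
    where
    linked-at : ∀ {c i} → InClass c y → ev i y ≡ true → Linked c i
    linked-at {c} {i} y∈c ev≡true with Linked? c i
    ... | yes ci = ci
    ... | no ¬ci = ⊥-elim (false≢true (trans (sym (y∈c i ¬ci)) ev≡true))
  ... | no ∄i = ⊥-elim (y≢0 (ev-ext y 0ᵥ λ i → trans (¬-not (λ ev≡true → ∄i (i , ev≡true))) (sym (ev-0 i))))

-- Crossing pairs of points

lt : ∀ {n} → Fin n → Fin n → Bool
lt a b = does (a <?ᶠ b)

lt-true : ∀ {n} {a b : Fin n} → a <ᶠ b → lt a b ≡ true
lt-true {a = a} {b} = dec-true (a <?ᶠ b)

lt-false : ∀ {n} {a b : Fin n} → ¬ a <ᶠ b → lt a b ≡ false
lt-false {a = a} {b} = dec-false (a <?ᶠ b)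

lt-sound : ∀ {n} {a b : Fin n} → lt a b ≡ true → a <ᶠ b
lt-sound {a = a} {b} = does-sound (a <?ᶠ b)

lt-flip : ∀ {n} {a b : Fin n} → a ≢ b → lt b a ≡ not (lt a b)
lt-flip {a = a} {b} a≢b with <-cmp a b
... | tri< a<b _ _ = trans (lt-false (<-asym a<b)) (cong not (sym (lt-true a<b)))
... | tri≈ _ a≡b _ = ⊥-elim (a≢b a≡b)
... | tri> _ _ b<a = trans (lt-true b<a) (cong not (sym (lt-false (<-asym b<a))))

-- for x ∉ {a, c}: x lies strictly between a and c
between : ∀ {n} → Fin n → Fin n → Fin n → Bool
between x a c = lt a x xor lt c x

-- for distinct points: the pairs {a, c} and {b, d} interleave
crosses : ∀ {n} → Fin n → Fin n → Fin n → Fin n → Bool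
crosses a c b d = between b a c xor between d a c

Distinct4 : ∀ {n} → Fin n → Fin n → Fin n → Fin n → Set
Distinct4 a b c d = a ≢ b × a ≢ c × a ≢ d × b ≢ c × b ≢ d × c ≢ d

xor-telescope : ∀ x y z → (x xor y) xor (y xor z) ≡ x xor z
xor-telescope x y z = begin
  (x xor y) xor (y xor z)  ≡⟨ xor-assoc x y (y xor z) ⟩
  x xor (y xor (y xor z))  ≡⟨ cong (x xor_) (sym (xor-assoc y y z)) ⟩
  x xor ((y xor y) xor z)  ≡⟨ cong (λ w → x xor (w xor z)) (xor-same y) ⟩
  x xor z                  ∎

crosses-swapˡ : ∀ {n} (a c b d : Fin n) → crosses a c b d ≡ crosses c a b d
crosses-swapˡ a c b d = cong₂ _xor_ (xor-comm (lt a b) (lt c b)) (xor-comm (lt a d) (lt c d))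

crosses-swapʳ : ∀ {n} (a c b d : Fin n) → crosses a c b d ≡ crosses a c d b
crosses-swapʳ a c b d = xor-comm (between b a c) (between d a c)

crosses-sym : ∀ {n} {a c b d : Fin n} → Distinct4 a c b d → crosses a c b d ≡ crosses b d a c
crosses-sym {a = a} {c} {b} {d} (_ , a≢b , a≢d , c≢b , c≢d , _) = sym (begin
  (lt b a xor lt d a) xor (lt b c xor lt d c)
    ≡⟨ cong₂ _xor_ (cong₂ _xor_ (lt-flip a≢b) (lt-flip a≢d)) (cong₂ _xor_ (lt-flip c≢b) (lt-flip c≢d)) ⟩
  (not (lt a b) xor not (lt a d)) xor (not (lt c b) xor not (lt c d))
    ≡⟨ cong₂ _xor_ (xor-annihilates-not (lt a b) (lt a d)) (xor-annihilates-not (lt c b) (lt c d)) ⟩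
  (lt a b xor lt a d) xor (lt c b xor lt c d)
    ≡⟨ xor-interchange (lt a b) (lt a d) (lt c b) (lt c d) ⟩
  (lt a b xor lt c b) xor (lt a d xor lt c d)
    ∎)

crosses-telescope : ∀ {n} (a x c b d : Fin n) → crosses a x b d xor crosses x c b d ≡ crosses a c b d
crosses-telescope a x c b d = begin
  (between b a x xor between d a x) xor (between b x c xor between d x c)
    ≡⟨ xor-interchange (between b a x) (between d a x) (between b x c) (between d x c) ⟩
  (between b a x xor between b x c) xor (between d a x xor between d x c)
    ≡⟨ cong₂ _xor_ (xor-telescope (lt a b) (lt x b) (lt c b)) (xor-telescope (lt a d) (lt x d) (lt c d)) ⟩
  between b a c xor between d a c
    ∎

-- Of the three ways to match four distinct points into two pairs, exactly one is crossing.
crosses-matchings : ∀ {n} {i j k l : Fin n} → Distinct4 i j k l →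
  crosses i k j l xor crosses i l j k ≡ not (crosses i j k l)
crosses-matchings {i = i} {j} {k} {l} D@(_ , i≢k , i≢l , _ , _ , k≢l) = begin
  (between j i k xor between l i k) xor (between j i l xor between k i l)
    ≡⟨ xor-interchange (between j i k) (between l i k) (between j i l) (between k i l) ⟩
  (between j i k xor between j i l) xor (between l i k xor between k i l)
    ≡⟨ cong₂ _xor_ (trans (cong (_xor between j i l) (xor-comm (lt i j) (lt k j))) (xor-telescope (lt k j) (lt i j) (lt l j)))
                   rotate ⟩
  between j k l xor not (between i k l)
    ≡⟨ sym (not-distribʳ-xor (between j k l) (between i k l)) ⟩
  not (crosses k l j i)
    ≡⟨ cong not (trans (crosses-swapʳ k l j i) (crosses-sym (swap-pairs D))) ⟩
  not (crosses i j k l)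
    ∎
  where
  swap-pairs : Distinct4 i j k l → Distinct4 k l i j
  swap-pairs (i≢j , i≢k , i≢l , j≢k , j≢l , k≢l) =
    k≢l , (λ k≡i → i≢k (sym k≡i)) , (λ k≡j → j≢k (sym k≡j)) , (λ l≡i → i≢l (sym l≡i)) , (λ l≡j → j≢l (sym l≡j)) , i≢j
  parity : ∀ x y z → (not x xor y) xor (not z xor not y) ≡ not (z xor x)
  parity false false false = refl
  parity false false true  = refl
  parity false true  false = refl
  parity false true  true  = refl
  parity true  false false = refl
  parity true  false true  = refl
  parity true  true  false = refl
  parity true  true  true  = refl
  rotate : between l i k xor between k i l ≡ not (between i k l)
  rotate rewrite lt-flip {a = l} {i} (λ l≡i → i≢l (sym l≡i)) | lt-flip {a = k} {i} (λ k≡i → i≢k (sym k≡i))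
               | lt-flip k≢l = parity (lt l i) (lt k l) (lt k i)

crosses-ordered : ∀ {n} {a b c d : Fin n} → a <ᶠ b → b <ᶠ c → c <ᶠ d → crosses a c b d ≡ true
crosses-ordered {a = a} {b} {c} {d} a<b b<c c<d
  rewrite lt-true a<b | lt-false {a = c} {b} (<-asym b<c) | lt-true (<-trans a<b (<-trans b<c c<d)) | lt-true c<d = refl

distinct-ordered : ∀ {n} {a b c d : Fin n} → a <ᶠ b → b <ᶠ c → c <ᶠ d → Distinct4 a c b d
distinct-ordered a<b b<c c<d =
  <⇒≢ (<-trans a<b b<c) , <⇒≢ a<b , <⇒≢ (<-trans a<b (<-trans b<c c<d)) ,
  (λ c≡b → <⇒≢ b<c (sym c≡b)) , <⇒≢ c<d , <⇒≢ (<-trans b<c c<d)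

module _ {n} {ρ : Partition n} (nc : NonCrossing ρ) where

  private
    sorted : ∀ {a c b d} → a <ᶠ c → b <ᶠ d → a <ᶠ b → c ≢ b → crosses a c b d ≡ true →
      ρ a ≡ ρ c → ρ b ≡ ρ d → ρ a ≡ ρ b
    sorted {a} {c} {b} {d} a<c b<d a<b c≢b cr ρac ρbd with <-cmp b c
    ... | tri≈ _ b≡c _ = ⊥-elim (c≢b (sym b≡c))
    ... | tri> _ _ c<b
      rewrite lt-true a<b | lt-true c<b | lt-true (<-trans a<b b<d) | lt-true (<-trans c<b b<d) = ⊥-elim (false≢true cr)
    ... | tri< b<c _ _
      rewrite lt-true a<b | lt-false {a = c} {b} (<-asym b<c) | lt-true (<-trans a<b b<d) =
      nc a b c d a<b b<c (lt-sound (trans (sym (not-involutive (lt c d))) cr)) ρac ρbd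

    oriented : ∀ {a c b d} → Distinct4 a c b d → a <ᶠ c → b <ᶠ d → crosses a c b d ≡ true →
      ρ a ≡ ρ c → ρ b ≡ ρ d → ρ a ≡ ρ b
    oriented {a} {c} {b} {d} D@(_ , a≢b , a≢d , c≢b , _ , _) a<c b<d cr ρac ρbd with <-cmp a b
    ... | tri< a<b _ _ = sorted a<c b<d a<b c≢b cr ρac ρbd
    ... | tri≈ _ a≡b _ = ⊥-elim (a≢b a≡b)
    ... | tri> _ _ b<a = sym (sorted b<d a<c b<a (λ d≡a → a≢d (sym d≡a)) (trans (sym (crosses-sym D)) cr) ρbd ρac)

  noncrossing-crosses : ∀ {a c b d} → Distinct4 a c b d → crosses a c b d ≡ true →
    ρ a ≡ ρ c → ρ b ≡ ρ d → ρ a ≡ ρ b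
  noncrossing-crosses {a} {c} {b} {d} D@(a≢c , a≢b , a≢d , c≢b , c≢d , b≢d) cr ρac ρbd
    with <-cmp a c | <-cmp b d
  ... | tri≈ _ a≡c _ | _            = ⊥-elim (a≢c a≡c)
  ... | _            | tri≈ _ b≡d _ = ⊥-elim (b≢d b≡d)
  ... | tri< a<c _ _ | tri< b<d _ _ = oriented D a<c b<d cr ρac ρbd
  ... | tri< a<c _ _ | tri> _ _ d<b =
    trans (oriented (a≢c , a≢d , a≢b , c≢d , c≢b , ≢-sym b≢d) a<c d<b (trans (sym (crosses-swapʳ a c b d)) cr) ρac (sym ρbd))
          (sym ρbd)
  ... | tri> _ _ c<a | tri< b<d _ _ =
    trans ρac (oriented (≢-sym a≢c , c≢b , c≢d , a≢b , a≢d , b≢d) c<a b<d (trans (sym (crosses-swapˡ a c b d)) cr) (sym ρac) ρbd)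
  ... | tri> _ _ c<a | tri> _ _ d<b =
    trans ρac (trans (oriented (≢-sym a≢c , c≢d , c≢b , a≢d , a≢b , ≢-sym b≢d) c<a d<b
                        (trans (sym (trans (crosses-swapˡ a c b d) (crosses-swapʳ c a b d))) cr) (sym ρac) (sym ρbd))
                     (sym ρbd))

-- Edges in one- and two-dimensional spaces f(ρ)

IsEdge : ∀ {m} → Vect m → Set
IsEdge {m} x = ∃[ a ] ∃[ b ] (x ≡ edge {m} a b)

NoncrossingPairSum : ∀ {m} → Vect m → Vect m → Set
NoncrossingPairSum {m} x y = ∃[ i ] ∃[ j ] ∃[ k ] ∃[ l ]
  (y ≡ edge {m} i j × x ≡ edge i j ⊕ edge k l × Distinct4 i j k l × crosses i j k l ≡ false)

zero-isSubspace : ∀ {k} → IsSubspace {k} (_≡ 0ᵥ)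
zero-isSubspace = record { 0∈ = refl ; ⊕∈ = λ { refl refl → ⊕-self 0ᵥ } }

plane-cases : ∀ {k} {x y w : Vect k} → Plane x y w → w ≡ 0ᵥ ⊎ w ≡ x ⊎ w ≡ y ⊎ w ≡ x ⊕ y
plane-cases {x = x} {y} (false , false , refl) = inj₁ (⊕-identityˡ 0ᵥ)
plane-cases {x = x} {y} (true  , false , refl) = inj₂ (inj₁ (⊕-identityʳ x))
plane-cases {x = x} {y} (false , true  , refl) = inj₂ (inj₂ (inj₁ (⊕-identityˡ y)))
plane-cases {x = x} {y} (true  , true  , refl) = inj₂ (inj₂ (inj₂ refl))

edge-sum : ∀ {m} (a b c d : Fin (suc m)) → IsEdge (edge a b ⊕ edge c d) ⊎ Distinct4 a b c d
edge-sum a b c d with a ≟ᶠ b | c ≟ᶠ d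
... | yes refl | _        = inj₁ (c , d , trans (cong (_⊕ edge c d) (edge-self a)) (⊕-identityˡ _))
... | no  _    | yes refl = inj₁ (a , b , trans (cong (edge a b ⊕_) (edge-self c)) (⊕-identityʳ _))
... | no a≢b   | no c≢d with a ≟ᶠ c | a ≟ᶠ d | b ≟ᶠ c | b ≟ᶠ d
...   | yes refl | _        | _        | _        = inj₁ (b , d , trans (cong (_⊕ edge a d) (edge-sym a b)) (edge-trans b a d))
...   | no  _    | yes refl | _        | _        = inj₁ (b , c , trans (cong₂ _⊕_ (edge-sym a b) (edge-sym c a)) (edge-trans b a c))
...   | no  _    | no  _    | yes refl | _        = inj₁ (a , d , edge-trans a b d)
...   | no  _    | no  _    | no  _    | yes refl = inj₁ (a , c , trans (cong (edge a b ⊕_) (edge-sym c b)) (edge-trans a b c))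
...   | no a≢c   | no a≢d   | no b≢c   | no b≢d   = inj₂ (a≢b , a≢c , a≢d , b≢c , b≢d , c≢d)

f-line : ∀ {m} (ρ : Partition (suc m)) {x} → x ≢ 0ᵥ → f ρ x → f ρ ⊆ᵥ Pair x → IsEdge x
f-line ρ x≢0 x∈fρ fρ⊆ with generator-∉ zero-isSubspace (_≟ᵥ 0ᵥ) x∈fρ x≢0
... | _ , (i , j , ρi≡ρj , refl) , g≢0 with fρ⊆ _ (sameBlock⇒edge∈f ρ i j ρi≡ρj)
...   | inj₁ g≡0 = ⊥-elim (g≢0 g≡0)
...   | inj₂ g≡x = i , j , sym g≡x

module _ {m} {ρ : Partition (suc m)} (nc : NonCrossing ρ) {x y : Vect m} (fρ⊆ : f ρ ⊆ᵥ Plane x y) where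

  private
    -- If the pairs {k, l} and {i, j} crossed, ρ would put k and i in one block and e_k + e_i would
    -- be a fifth nonzero vector of the plane.
    pairs-in-blocks : ∀ {i j k l} → y ≡ edge k l → x ⊕ y ≡ edge i j → ρ k ≡ ρ l → ρ i ≡ ρ j →
      IsEdge x ⊎ NoncrossingPairSum x y
    pairs-in-blocks {i} {j} {k} {l} y≡kl x⊕y≡ij ρk≡ρl ρi≡ρj with edge-sum k l i j
    ... | inj₁ (a , b , sum≡ab) = inj₁ (a , b , trans (x≡y⊕[x⊕y] x y) (trans (cong₂ _⊕_ y≡kl x⊕y≡ij) sum≡ab))
    ... | inj₂ D@(k≢l , k≢i , _ , l≢i , _ , _) with crosses k l i j in cr
    ...   | false = inj₂ (k , l , i , j , y≡kl , trans (x≡y⊕[x⊕y] x y) (cong₂ _⊕_ y≡kl x⊕y≡ij) , D , cr)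
    ...   | true with plane-cases (fρ⊆ _ (sameBlock⇒edge∈f ρ k i (noncrossing-crosses nc D cr ρk≡ρl ρi≡ρj)))
    ...     | inj₁ ki≡0 = ⊥-elim (k≢i (edge≡0⇒≡ ki≡0))
    ...     | inj₂ (inj₁ ki≡x) = inj₁ (k , i , sym ki≡x)
    ...     | inj₂ (inj₂ (inj₁ ki≡y)) with edge-injective (trans ki≡y y≡kl) k≢i
    ...       | inj₁ (_ , i≡l) = ⊥-elim (l≢i (sym i≡l))
    ...       | inj₂ (k≡l , _) = ⊥-elim (k≢l k≡l)
    pairs-in-blocks {i} {j} {k} {l} y≡kl x⊕y≡ij ρk≡ρl ρi≡ρj
      | inj₂ D@(_ , k≢i , k≢j , _ , _ , _) | true | inj₂ (inj₂ (inj₂ ki≡x⊕y)) with edge-injective (trans ki≡x⊕y x⊕y≡ij) k≢i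
    ...       | inj₁ (k≡i , _) = ⊥-elim (k≢i k≡i)
    ...       | inj₂ (k≡j , _) = ⊥-elim (k≢j k≡j)

  -- Unless x is an edge, generators of f(ρ) avoiding {0, y} and {0, x + y} are x + y and y.
  f-plane : f ρ x → x ≢ 0ᵥ → y ≢ 0ᵥ → x ≢ y → IsEdge x ⊎ NoncrossingPairSum x y
  f-plane x∈fρ x≢0 y≢0 x≢y
    with generator-∉ (pair-isSubspace y) (pair? y) x∈fρ [ x≢0 , x≢y ]
  ... | _ , (i , j , ρi≡ρj , refl) , ij∉ with plane-cases (fρ⊆ _ (sameBlock⇒edge∈f ρ i j ρi≡ρj))
  ...   | inj₁ ij≡0 = ⊥-elim (ij∉ (inj₁ ij≡0))
  ...   | inj₂ (inj₁ ij≡x) = inj₁ (i , j , sym ij≡x)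
  ...   | inj₂ (inj₂ (inj₁ ij≡y)) = ⊥-elim (ij∉ (inj₂ ij≡y))
  ...   | inj₂ (inj₂ (inj₂ ij≡x⊕y))
    with generator-∉ (pair-isSubspace (x ⊕ y)) (pair? (x ⊕ y)) x∈fρ [ x≢0 , x≢x⊕y ]
    where
    x≢x⊕y : x ≢ x ⊕ y
    x≢x⊕y x≡x⊕y = y≢0 (sym (⊕-cancelˡ (trans (⊕-identityʳ x) x≡x⊕y)))
  ...     | _ , (k , l , ρk≡ρl , refl) , kl∉ with plane-cases (fρ⊆ _ (sameBlock⇒edge∈f ρ k l ρk≡ρl))
  ...       | inj₁ kl≡0 = ⊥-elim (kl∉ (inj₁ kl≡0))
  ...       | inj₂ (inj₁ kl≡x) = inj₁ (k , l , sym kl≡x)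
  ...       | inj₂ (inj₂ (inj₁ kl≡y)) = pairs-in-blocks (sym kl≡y) (sym ij≡x⊕y) ρk≡ρl ρi≡ρj
  ...       | inj₂ (inj₂ (inj₂ kl≡x⊕y)) = ⊥-elim (kl∉ (inj₂ kl≡x⊕y))

-- The three matchings of four points

crosses-edge-cong : ∀ {n} {a b c d a′ b′ c′ d′ : Fin (suc n)} → a ≢ b → c ≢ d →
  edge a b ≡ edge a′ b′ → edge c d ≡ edge c′ d′ → crosses a b c d ≡ crosses a′ b′ c′ d′
crosses-edge-cong {a = a} {b} {c} {d} a≢b c≢d ab≡ cd≡ with edge-injective ab≡ a≢b | edge-injective cd≡ c≢d
... | inj₁ (refl , refl) | inj₁ (refl , refl) = refl
... | inj₁ (refl , refl) | inj₂ (refl , refl) = crosses-swapʳ a b c d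
... | inj₂ (refl , refl) | inj₁ (refl , refl) = crosses-swapˡ a b c d
... | inj₂ (refl , refl) | inj₂ (refl , refl) = trans (crosses-swapˡ a b c d) (crosses-swapʳ b a c d)

OneOf4 : ∀ {n} → Fin n → Fin n → Fin n → Fin n → Fin n → Set
OneOf4 x i j k l = x ≡ i ⊎ x ≡ j ⊎ x ≡ k ⊎ x ≡ l

ev-pairSum-support : ∀ {m} {i j k l : Fin (suc m)} x → ev x (edge i j ⊕ edge k l) ≡ true → OneOf4 x i j k l
ev-pairSum-support {i = i} {j} {k} {l} x h with x ≟ᶠ i | x ≟ᶠ j | x ≟ᶠ k | x ≟ᶠ l
... | yes x≡i | _       | _       | _       = inj₁ x≡i
... | no  _   | yes x≡j | _       | _       = inj₂ (inj₁ x≡j)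
... | no  _   | no  _   | yes x≡k | _       = inj₂ (inj₂ (inj₁ x≡k))
... | no  _   | no  _   | no  _   | yes x≡l = inj₂ (inj₂ (inj₂ x≡l))
... | no x≢i  | no x≢j  | no x≢k  | no x≢l  = ⊥-elim (false≢true (begin
  false                                   ≡⟨⟩
  (false xor false) xor (false xor false) ≡⟨ sym (cong₂ _xor_ (cong₂ _xor_ (δ-false x≢i) (δ-false x≢j))
                                                                (cong₂ _xor_ (δ-false x≢k) (δ-false x≢l))) ⟩
  (δ x i xor δ x j) xor (δ x k xor δ x l) ≡⟨ sym (cong₂ _xor_ (ev-edge x i j) (ev-edge x k l)) ⟩
  ev x (edge i j) xor ev x (edge k l)     ≡⟨ sym (ev-linear x (edge i j) (edge k l)) ⟩
  ev x (edge i j ⊕ edge k l)              ≡⟨ h ⟩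
  true                                    ∎))

ev-pairSum-first : ∀ {m} {a b c d : Fin (suc m)} → Distinct4 a b c d → ev a (edge a b ⊕ edge c d) ≡ true
ev-pairSum-first {a = a} {b} {c} {d} (a≢b , a≢c , a≢d , _ , _ , _) =
  trans (ev-linear a (edge a b) (edge c d))
        (cong₂ _xor_ (trans (ev-edge a a b) (cong₂ _xor_ (δ-refl a) (δ-false a≢b)))
                     (trans (ev-edge a c d) (cong₂ _xor_ (δ-false a≢c) (δ-false a≢d))))

edge-matching : ∀ {m} {i j k l a b : Fin (suc m)} → a ≢ b → OneOf4 a i j k l → OneOf4 b i j k l →
  (edge a b ≡ edge i j ⊎ edge a b ≡ edge k l) ⊎
  (edge a b ≡ edge i k ⊎ edge a b ≡ edge j l) ⊎
  (edge a b ≡ edge i l ⊎ edge a b ≡ edge j k)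
edge-matching a≢b (inj₁ refl)                (inj₁ refl)                = ⊥-elim (a≢b refl)
edge-matching a≢b (inj₁ refl)                (inj₂ (inj₁ refl))         = inj₁ (inj₁ refl)
edge-matching a≢b (inj₁ refl)                (inj₂ (inj₂ (inj₁ refl)))  = inj₂ (inj₁ (inj₁ refl))
edge-matching a≢b (inj₁ refl)                (inj₂ (inj₂ (inj₂ refl)))  = inj₂ (inj₂ (inj₁ refl))
edge-matching a≢b (inj₂ (inj₁ refl))         (inj₁ refl)                = inj₁ (inj₁ (edge-sym _ _))
edge-matching a≢b (inj₂ (inj₁ refl))         (inj₂ (inj₁ refl))         = ⊥-elim (a≢b refl)
edge-matching a≢b (inj₂ (inj₁ refl))         (inj₂ (inj₂ (inj₁ refl)))  = inj₂ (inj₂ (inj₂ refl))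
edge-matching a≢b (inj₂ (inj₁ refl))         (inj₂ (inj₂ (inj₂ refl)))  = inj₂ (inj₁ (inj₂ refl))
edge-matching a≢b (inj₂ (inj₂ (inj₁ refl)))  (inj₁ refl)                = inj₂ (inj₁ (inj₁ (edge-sym _ _)))
edge-matching a≢b (inj₂ (inj₂ (inj₁ refl)))  (inj₂ (inj₁ refl))         = inj₂ (inj₂ (inj₂ (edge-sym _ _)))
edge-matching a≢b (inj₂ (inj₂ (inj₁ refl)))  (inj₂ (inj₂ (inj₁ refl)))  = ⊥-elim (a≢b refl)
edge-matching a≢b (inj₂ (inj₂ (inj₁ refl)))  (inj₂ (inj₂ (inj₂ refl)))  = inj₁ (inj₂ refl)
edge-matching a≢b (inj₂ (inj₂ (inj₂ refl)))  (inj₁ refl)                = inj₂ (inj₂ (inj₁ (edge-sym _ _)))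
edge-matching a≢b (inj₂ (inj₂ (inj₂ refl)))  (inj₂ (inj₁ refl))         = inj₂ (inj₁ (inj₂ (edge-sym _ _)))
edge-matching a≢b (inj₂ (inj₂ (inj₂ refl)))  (inj₂ (inj₂ (inj₁ refl)))  = inj₁ (inj₂ (edge-sym _ _))
edge-matching a≢b (inj₂ (inj₂ (inj₂ refl)))  (inj₂ (inj₂ (inj₂ refl)))  = ⊥-elim (a≢b refl)

data Matching {m} (i j k l : Fin (suc m)) (y : Vect m) : Set where
  ij∣kl : y ≡ edge i j ⊎ y ≡ edge k l → Matching i j k l y
  ik∣jl : y ≡ edge i k ⊎ y ≡ edge j l → crosses i k j l ≡ false → Matching i j k l y
  il∣jk : y ≡ edge i l ⊎ y ≡ edge j k → crosses i l j k ≡ false → Matching i j k l y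

pairSum-matching : ∀ {m} {i j k l : Fin (suc m)} {x y} → x ≡ edge i j ⊕ edge k l → Distinct4 i j k l →
  NoncrossingPairSum x y → Matching i j k l y
pairSum-matching {i = i} {j} {k} {l} {x} {y} x≡ (i≢j , i≢k , i≢l , j≢k , j≢l , k≢l)
                 (a , b , c , d , y≡ab , x≡′ , D′@(a≢b , a≢c , a≢d , b≢c , b≢d , c≢d) , cr) =
  classify (edge-matching a≢b (in-support (ev-pairSum-first D′))
                              (in-support (trans (cong (λ w → ev b (w ⊕ edge c d)) (edge-sym a b))
                                                 (ev-pairSum-first (≢-sym a≢b , b≢c , b≢d , a≢c , a≢d , c≢d)))))
  where
  in-support : ∀ {z} → ev z (edge a b ⊕ edge c d) ≡ true → OneOf4 z i j k l
  in-support h = ev-pairSum-support _ (trans (cong (ev _) (trans (sym x≡) x≡′)) h)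

  partner : ∀ {p q} → x ≡ p ⊕ q → edge a b ≡ p → edge c d ≡ q
  partner {p} {q} x≡pq ab≡p = begin
    edge c d                        ≡⟨ sym (x⊕y⊕x≡y (edge a b) (edge c d)) ⟩
    edge a b ⊕ edge c d ⊕ edge a b  ≡⟨ cong₂ _⊕_ (trans (sym x≡′) x≡pq) ab≡p ⟩
    p ⊕ q ⊕ p                       ≡⟨ x⊕y⊕x≡y p q ⟩
    q                               ∎

  x≡ik⊕jl : x ≡ edge i k ⊕ edge j l
  x≡ik⊕jl = trans x≡ (sym (edge-interchange i j k l))

  x≡il⊕jk : x ≡ edge i l ⊕ edge j k
  x≡il⊕jk = trans x≡ (sym (edge-interchange′ i j k l))

  crossing : ∀ {a′ b′ c′ d′} → edge a b ≡ edge a′ b′ → edge c d ≡ edge c′ d′ → crosses a′ b′ c′ d′ ≡ false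
  crossing ab≡ cd≡ = trans (sym (crosses-edge-cong a≢b c≢d ab≡ cd≡)) cr

  classify : (edge a b ≡ edge i j ⊎ edge a b ≡ edge k l) ⊎ (edge a b ≡ edge i k ⊎ edge a b ≡ edge j l) ⊎
             (edge a b ≡ edge i l ⊎ edge a b ≡ edge j k) → Matching i j k l y
  classify (inj₁ (inj₁ ab≡ij)) = ij∣kl (inj₁ (trans y≡ab ab≡ij))
  classify (inj₁ (inj₂ ab≡kl)) = ij∣kl (inj₂ (trans y≡ab ab≡kl))
  classify (inj₂ (inj₁ (inj₁ ab≡ik))) = ik∣jl (inj₁ (trans y≡ab ab≡ik)) (crossing ab≡ik (partner x≡ik⊕jl ab≡ik))
  classify (inj₂ (inj₁ (inj₂ ab≡jl))) = ik∣jl (inj₂ (trans y≡ab ab≡jl))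
    (trans (crosses-sym (i≢k , i≢j , i≢l , ≢-sym j≢k , k≢l , j≢l))
           (crossing ab≡jl (partner (trans x≡ik⊕jl (⊕-comm _ _)) ab≡jl)))
  classify (inj₂ (inj₂ (inj₁ ab≡il))) = il∣jk (inj₁ (trans y≡ab ab≡il)) (crossing ab≡il (partner x≡il⊕jk ab≡il))
  classify (inj₂ (inj₂ (inj₂ ab≡jk))) = il∣jk (inj₂ (trans y≡ab ab≡jk))
    (trans (crosses-sym (i≢l , i≢j , i≢k , ≢-sym j≢l , ≢-sym k≢l , j≢k))
           (crossing ab≡jk (partner (trans x≡il⊕jk (⊕-comm _ _)) ab≡jk)))

-- the pairs {y, x + y} and {z, x + z} differ
Apart : ∀ {m} → Vect m → Vect m → Vect m → Set
Apart x y z = y ≢ z × y ⊕ z ≢ x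

-- The pairs {y, x + y} for three mutually apart y would be the three matchings of the four points
-- of x, all noncrossing; but one of them crosses.
three-pairSums : ∀ {m} {x y₁ y₂ y₃ : Vect m} → Apart x y₁ y₂ → Apart x y₁ y₃ → Apart x y₂ y₃ →
  NoncrossingPairSum x y₁ → NoncrossingPairSum x y₂ → NoncrossingPairSum x y₃ → ⊥
three-pairSums {x = x} apart₁₂ apart₁₃ apart₂₃ (i , j , k , l , y₁≡ij , x≡ , D , cr) q₂ q₃ =
  combine (pairSum-matching x≡ D q₂) (pairSum-matching x≡ D q₃)
  where
  sameMatching : ∀ {y z p q} → Apart x y z → y ≡ p ⊎ y ≡ q → z ≡ p ⊎ z ≡ q → p ⊕ q ≡ x → ⊥
  sameMatching (y≢z , _) (inj₁ y≡p) (inj₁ z≡p) _ = y≢z (trans y≡p (sym z≡p))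
  sameMatching (y≢z , _) (inj₂ y≡q) (inj₂ z≡q) _ = y≢z (trans y≡q (sym z≡q))
  sameMatching (_ , y⊕z≢x) (inj₁ y≡p) (inj₂ z≡q) p⊕q≡x = y⊕z≢x (trans (cong₂ _⊕_ y≡p z≡q) p⊕q≡x)
  sameMatching (_ , y⊕z≢x) (inj₂ y≡q) (inj₁ z≡p) p⊕q≡x =
    y⊕z≢x (trans (cong₂ _⊕_ y≡q z≡p) (trans (⊕-comm _ _) p⊕q≡x))
  allNoncrossing : crosses i k j l ≡ false → crosses i l j k ≡ false → ⊥
  allNoncrossing c₁ c₂ = false≢true (begin
    false                                    ≡⟨ cong₂ _xor_ c₁ c₂ ⟨
    crosses i k j l xor crosses i l j k      ≡⟨ crosses-matchings D ⟩
    not (crosses i j k l)                    ≡⟨ cong not cr ⟩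
    true                                     ∎)
  combine : Matching i j k l _ → Matching i j k l _ → ⊥
  combine (ij∣kl m₂)   _             = sameMatching apart₁₂ (inj₁ y₁≡ij) m₂ (sym x≡)
  combine _            (ij∣kl m₃)    = sameMatching apart₁₃ (inj₁ y₁≡ij) m₃ (sym x≡)
  combine (ik∣jl m₂ _) (ik∣jl m₃ _)  = sameMatching apart₂₃ m₂ m₃ (sym (trans x≡ (sym (edge-interchange i j k l))))
  combine (il∣jk m₂ _) (il∣jk m₃ _)  = sameMatching apart₂₃ m₂ m₃ (sym (trans x≡ (sym (edge-interchange′ i j k l))))
  combine (ik∣jl _ c₁) (il∣jk _ c₂)  = allNoncrossing c₁ c₂
  combine (il∣jk _ c₂) (ik∣jl _ c₁)  = allNoncrossing c₁ c₂

another-or-only : ∀ {n} (S : Fin n → Bool) s₀ → (∃[ s ] (S s ≡ true × s₀ ≢ s)) ⊎ (∀ s → S s ≡ true → s ≡ s₀)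
another-or-only S s₀ with any? (λ s → (S s ≟ᵇ true) ×-dec ¬? (s₀ ≟ᶠ s))
... | yes found = inj₁ found
... | no  none  = inj₂ λ s Ss → decidable-stable (s ≟ᶠ s₀) (λ s≢s₀ → none (s , Ss , ≢-sym s≢s₀))

two-outside-or-not : ∀ {n} (S : Fin n → Bool) →
  (∃[ t ] ∃[ t′ ] (t ≢ t′ × S t ≡ false × S t′ ≡ false)) ⊎ (∀ t t′ → S t ≡ false → S t′ ≡ false → t ≡ t′)
two-outside-or-not S with any? (λ t → any? (λ t′ → ¬? (t ≟ᶠ t′) ×-dec (S t ≟ᵇ false) ×-dec (S t′ ≟ᵇ false)))
... | yes (t , t′ , found) = inj₁ (t , t′ , found)
... | no  none = inj₂ λ t t′ St St′ → decidable-stable (t ≟ᶠ t′) (λ t≢t′ → none (t , t′ , t≢t′ , St , St′))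

three-others : ∀ {k} (s : Fin (4 + k)) → ∃[ t₁ ] ∃[ t₂ ] ∃[ t₃ ] Distinct4 s t₁ t₂ t₃
three-others fz                = fs fz , fs (fs fz) , fs (fs (fs fz)) , (λ ()) , (λ ()) , (λ ()) , (λ ()) , (λ ()) , (λ ())
three-others (fs fz)           = fz , fs (fs fz) , fs (fs (fs fz)) , (λ ()) , (λ ()) , (λ ()) , (λ ()) , (λ ()) , (λ ())
three-others (fs (fs fz))      = fz , fs fz , fs (fs (fs fz)) , (λ ()) , (λ ()) , (λ ()) , (λ ()) , (λ ()) , (λ ())
three-others (fs (fs (fs s)))  = fz , fs fz , fs (fs fz) , (λ ()) , (λ ()) , (λ ()) , (λ ()) , (λ ()) , (λ ())

ThreePoints : ∀ {n} → (Fin n → Bool) → Set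
ThreePoints S = ∃[ s₁ ] ∃[ s₂ ] ∃[ s₃ ] ((S s₁ ≡ true × S s₂ ≡ true × S s₃ ≡ true) × s₁ ≢ s₂ × s₁ ≢ s₃ × s₂ ≢ s₃)

three-inside : ∀ {k} (S : Fin (4 + k) → Bool) → (∀ t t′ → S t ≡ false → S t′ ≡ false → t ≡ t′) → ThreePoints S
three-inside S one-outside with any? (λ t → S t ≟ᵇ false)
... | yes (t , St) = besides (three-others t)
  where
  besides : ∃[ t₁ ] ∃[ t₂ ] ∃[ t₃ ] Distinct4 t t₁ t₂ t₃ → ThreePoints S
  besides (t₁ , t₂ , t₃ , t≢t₁ , t≢t₂ , t≢t₃ , D) = t₁ , t₂ , t₃ , (inside t≢t₁ , inside t≢t₂ , inside t≢t₃) , D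
    where
    inside : ∀ {t′} → t ≢ t′ → S t′ ≡ true
    inside t≢t′ = ¬-not λ St′ → t≢t′ (one-outside _ _ St St′)
... | no none = besides (three-others fz)
  where
  besides : ∃[ t₁ ] ∃[ t₂ ] ∃[ t₃ ] Distinct4 fz t₁ t₂ t₃ → ThreePoints S
  besides (t₁ , t₂ , t₃ , _ , _ , _ , D) = t₁ , t₂ , t₃ , (inside , inside , inside) , D
    where
    inside : ∀ {t′} → S t′ ≡ true
    inside = ¬-not λ St′ → none (_ , St′)

-- The link of a vertex of the apartment

StrictlyComparable : ∀ {m} → (Fin m → Bool) → (Fin m → Bool) → Set
StrictlyComparable S T = (T ⊆ᵇ S × ∃[ i ] (S i ≡ true × T i ≡ false))
                       ⊎ (S ⊆ᵇ T × ∃[ i ] (T i ≡ true × S i ≡ false))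

NoncrossingSpan : ∀ {m} → (Fin m → Vect m) → (Fin m → Bool) → Set
NoncrossingSpan {m} v T = ∃[ ρ ] (NonCrossing {suc m} ρ × spanOf v T ≐ f ρ)

-- The vertex spanOf v T of A forms with p an edge of A, hence lies in the link.
link-vertex : ∀ {m} {v : Fin m → Vect m} {S} {p} → IsBasis v → ProperNonEmpty S → p ≐ spanOf v S →
  LinkInNCP (suc m) v p → ∀ T → ProperNonEmpty T → StrictlyComparable S T → NoncrossingSpan v T
link-vertex {v = v} {S} {p} basis S-pne p≐ link T T-pne S≶T with link (spanOf v T ∷ []) (simplexT , p∉ , simplexPT)
  where
  open Basis basis
  vertexT : VertexA v (spanOf v T)
  vertexT = T , T-pne , (λ _ h → h) , (λ _ h → h)
  simplexT : SimplexA v (spanOf v T ∷ [])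
  simplexT = vertexT ∷ [] , λ { (here refl) (here refl) → inj₁ (λ _ h → h) }
  p∉ : ¬ Any (_≐ p) (spanOf v T ∷ [])
  p∉ (here (T⊆p , p⊆T)) = distinct S≶T
    where
    distinct : StrictlyComparable S T → ⊥
    distinct (inj₁ (_ , i , Si , Ti)) = spanOf-⊈ i Si Ti (λ w h → p⊆T w (proj₂ p≐ w h))
    distinct (inj₂ (_ , i , Ti , Si)) = spanOf-⊈ i Ti Si (λ w h → proj₁ p≐ w (T⊆p w h))
  comparable : StrictlyComparable S T → (p ⊆ᵥ spanOf v T) ⊎ (spanOf v T ⊆ᵥ p)
  comparable (inj₁ (T⊆S , _)) = inj₂ (λ w h → proj₂ p≐ w (spanOf-mono T⊆S w h))
  comparable (inj₂ (S⊆T , _)) = inj₁ (λ w h → spanOf-mono S⊆T w (proj₁ p≐ w h))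
  simplexPT : SimplexA v (p ∷ spanOf v T ∷ [])
  simplexPT = ((S , S-pne , p≐) ∷ vertexT ∷ []) , λ
    { (here refl)         (here refl)         → inj₁ (λ _ h → h)
    ; (here refl)         (there (here refl)) → comparable S≶T
    ; (there (here refl)) (here refl)         → swap (comparable S≶T)
    ; (there (here refl)) (there (here refl)) → inj₁ (λ _ h → h) }
... | (_ , ρ , nc , T≐fρ) ∷ [] , _ = ρ , nc , T≐fρ

module Link {m} {v : Fin m → Vect m} (basis : IsBasis v) {S : Fin m → Bool}
            (link : ∀ T → ProperNonEmpty T → StrictlyComparable S T → NoncrossingSpan v T) where

  open Basis basis
  open EdgeClasses (spanOf-isSubspace v S) (spanOf? S)

  Edges : Set
  Edges = ∀ s → S s ≡ true → IsEdge (v s)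

  LinksNoncrossing : Set
  LinksNoncrossing = ∀ a b c d → a <ᶠ b → b <ᶠ c → c <ᶠ d → Linked a c → Linked b d → Linked a b

  vertexNCP : ProperNonEmpty S → Edges → LinksNoncrossing → VertexNCP (suc m) (spanOf v S)
  vertexNCP ((s , Ss) , (t , St)) edges noncrossing =
    ((v s , v∈spanOf s Ss , v≢0 s) , (v t , v∉spanOf t St)) ,
    classOf , noncrossing-classOf noncrossing , spanOf⊆f , f-classOf⊆
    where
    spanOf⊆f : spanOf v S ⊆ᵥ f classOf
    spanOf⊆f = span-least (span-isSubspace _) λ { _ (s , Ss , refl) → edge∈f (edges s Ss) Ss }
      where
      edge∈f : ∀ {s} → IsEdge (v s) → S s ≡ true → f classOf (v s)
      edge∈f {s} (a , b , vs≡ab) Ss = subst (f classOf) (sym vs≡ab)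
        (sameBlock⇒edge∈f classOf a b (linked⇒sameClass (subst (spanOf v S) vs≡ab (v∈spanOf s Ss))))

  edges-nonsingleton : (∀ s → S s ≡ true → ∃[ s′ ] (S s′ ≡ true × s ≢ s′)) → Edges
  edges-nonsingleton other s Ss with other s Ss
  ... | s′ , Ss′ , s≢s′ with link (δ s) ((s , δ-refl s) , (s′ , δ-false s≢s′)) (inj₁ (δs⊆S , s′ , Ss′ , δ-false s≢s′))
    where
    δs⊆S : δ s ⊆ᵇ S
    δs⊆S i h = subst (λ z → S z ≡ true) (δ-true h) Ss
  ...   | ρ , _ , δs⊆f , f⊆δs =
    f-line ρ (v≢0 s) (δs⊆f _ (v∈spanOf s (δ-refl s))) (λ w h → spanOf-δ v s w (f⊆δs w h))

  module Singleton {s₀} (Ss₀ : S s₀ ≡ true) (only : ∀ i → S i ≡ true → i ≡ s₀) where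

    private
      S⊆δs₀ : S ⊆ᵇ δ s₀
      S⊆δs₀ i Si = subst (λ z → δ s₀ z ≡ true) (sym (only i Si)) (δ-refl s₀)

      S-false : ∀ {t} → s₀ ≢ t → S t ≡ false
      S-false s₀≢t = ¬-not λ St → s₀≢t (sym (only _ St))

      linked⇒≡v : ∀ {a b} → a ≢ b → Linked a b → edge a b ≡ v s₀
      linked⇒≡v a≢b ab with spanOf-δ v s₀ _ (spanOf-mono S⊆δs₀ _ ab)
      ... | inj₁ ab≡0  = ⊥-elim (a≢b (edge≡0⇒≡ ab≡0))
      ... | inj₂ ab≡v = ab≡v

    links-noncrossing : LinksNoncrossing
    links-noncrossing a b c d a<b b<c c<d ac bd = ⊥-elim (same-edge (distinct-ordered a<b b<c c<d))
      where
      same-edge : Distinct4 a c b d → ⊥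
      same-edge (a≢c , a≢b , a≢d , _ , _ , b≢d)
        with edge-injective (trans (linked⇒≡v a≢c ac) (sym (linked⇒≡v b≢d bd))) a≢c
      ... | inj₁ (a≡b , _) = a≢b a≡b
      ... | inj₂ (a≡d , _) = a≢d a≡d

    private
      edge-or-pairSum : ∀ {t t′} → s₀ ≢ t → s₀ ≢ t′ → t ≢ t′ → IsEdge (v s₀) ⊎ NoncrossingPairSum (v s₀) (v t)
      edge-or-pairSum {t} {t′} s₀≢t s₀≢t′ t≢t′ with link T T-pne (inj₂ (S⊆T , t , T-t , S-false s₀≢t))
        where
        T : Fin m → Bool
        T i = δ s₀ i ∨ δ t i
        T-t : T t ≡ true
        T-t = trans (cong (δ s₀ t ∨_) (δ-refl t)) (∨-zeroʳ _)
        T-pne : ProperNonEmpty T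
        T-pne = (s₀ , cong (_∨ δ t s₀) (δ-refl s₀)) , (t′ , cong₂ _∨_ (δ-false s₀≢t′) (δ-false t≢t′))
        S⊆T : S ⊆ᵇ T
        S⊆T i Si = subst (λ z → T z ≡ true) (sym (only i Si)) (cong (_∨ δ t s₀) (δ-refl s₀))
      ... | ρ , nc , T⊆f , f⊆T =
        f-plane nc (λ w h → spanOf-δ∨δ v s₀ t w (f⊆T w h))
                (T⊆f _ (v∈spanOf s₀ (cong (_∨ δ t s₀) (δ-refl s₀))))
                (v≢0 s₀) (v≢0 t) (v-injective s₀≢t)

    edges : ∃[ t₁ ] ∃[ t₂ ] ∃[ t₃ ] Distinct4 s₀ t₁ t₂ t₃ → Edges
    edges (t₁ , t₂ , t₃ , s₀≢t₁ , s₀≢t₂ , s₀≢t₃ , t₁≢t₂ , t₁≢t₃ , t₂≢t₃) s Ss rewrite only s Ss =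
      choose (edge-or-pairSum s₀≢t₁ s₀≢t₂ t₁≢t₂) (edge-or-pairSum s₀≢t₂ s₀≢t₃ t₂≢t₃)
             (edge-or-pairSum s₀≢t₃ s₀≢t₁ (≢-sym t₁≢t₃))
      where
      apart : ∀ {t t′} → s₀ ≢ t → s₀ ≢ t′ → t ≢ t′ → Apart (v s₀) (v t) (v t′)
      apart s₀≢t s₀≢t′ t≢t′ = v-injective t≢t′ , v⊕v≢v (≢-sym s₀≢t) (≢-sym s₀≢t′)
      choose : IsEdge (v s₀) ⊎ NoncrossingPairSum (v s₀) (v t₁) → IsEdge (v s₀) ⊎ NoncrossingPairSum (v s₀) (v t₂) →
               IsEdge (v s₀) ⊎ NoncrossingPairSum (v s₀) (v t₃) → IsEdge (v s₀)
      choose (inj₁ edge) _ _ = edge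
      choose _ (inj₁ edge) _ = edge
      choose _ _ (inj₁ edge) = edge
      choose (inj₂ q₁) (inj₂ q₂) (inj₂ q₃) = ⊥-elim (three-pairSums
        (apart s₀≢t₁ s₀≢t₂ t₁≢t₂) (apart s₀≢t₁ s₀≢t₃ t₁≢t₃) (apart s₀≢t₂ s₀≢t₃ t₂≢t₃) q₁ q₂ q₃)

  link-crossing : ∀ T → ProperNonEmpty T → StrictlyComparable S T → ∀ {P Q Y Z} → Distinct4 P Q Y Z →
    crosses P Q Y Z ≡ true → spanOf v T (edge P Q) → spanOf v T (edge Y Z) → spanOf v T (edge P Y)
  link-crossing T T-pne S≶T {P} {Q} {Y} {Z} D cr PQ∈T YZ∈T with link T T-pne S≶T
  ... | ρ , nc , T⊆f , f⊆T = f⊆T _ (sameBlock⇒edge∈f ρ P Y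
          (noncrossing-crosses nc D cr (edge∈f⇒sameBlock ρ P Q (T⊆f _ PQ∈T)) (edge∈f⇒sameBlock ρ Y Z (T⊆f _ YZ∈T))))

  module TwoOutside {t t′} (t≢t′ : t ≢ t′) (St : S t ≡ false) (St′ : S t′ ≡ false) (S-ne : ∃[ s ] S s ≡ true) where

    private
      in-extension : ∀ {u u′} → u ≢ u′ → S u ≡ false → S u′ ≡ false →
        ∀ {a b c d} → a <ᶠ b → b <ᶠ c → c <ᶠ d → Linked a c → Linked b d → spanOf v (λ i → S i ∨ δ u i) (edge a b)
      in-extension {u} {u′} u≢u′ Su Su′ a<b b<c c<d ac bd =
        link-crossing T T-pne (inj₂ (S⊆T , u , trans (cong (S u ∨_) (δ-refl u)) (∨-zeroʳ _) , Su))
          (distinct-ordered a<b b<c c<d) (crosses-ordered a<b b<c c<d) (spanOf-mono S⊆T _ ac) (spanOf-mono S⊆T _ bd)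
        where
        T : Fin m → Bool
        T i = S i ∨ δ u i
        S⊆T : S ⊆ᵇ T
        S⊆T i Si = cong (_∨ δ u i) Si
        T-pne : ProperNonEmpty T
        T-pne = (proj₁ S-ne , S⊆T _ (proj₂ S-ne)) , (u′ , cong₂ _∨_ Su′ (δ-false u≢u′))

    links-noncrossing : LinksNoncrossing
    links-noncrossing a b c d a<b b<c c<d ac bd =
      spanOf-mono ∩⊆S _ (spanOf-∩ (in-extension t≢t′ St St′ a<b b<c c<d ac bd)
                                  (in-extension (≢-sym t≢t′) St′ St a<b b<c c<d ac bd))
      where
      ∩⊆S : (λ i → (S i ∨ δ t i) ∧ (S i ∨ δ t′ i)) ⊆ᵇ S
      ∩⊆S i h with S i
      ... | true  = refl
      ... | false = ⊥-elim (t≢t′ (trans (δ-true (proj₁ (∧≡true⇒ h))) (sym (δ-true (proj₂ (∧≡true⇒ h))))))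

  -- Each summand of a vector in the class of a is an edge lying in that class or entirely outside it;
  -- the summands outside it add up to zero, so there are none.
  summands-inClass : Edges → ∀ a {D y} → D ⊆ᵇ S → y ≡ lincomb D v → InClass a y →
    ∀ s → D s ≡ true → InClass a (v s)
  summands-inClass edges a {D} {y} D⊆S y≡ y∈a s Ds =
    does-sound (inClass? a (v s))
      (not-injective (trans (cong (λ z → z ∧ not (does (inClass? a (v s)))) (sym Ds)) (proj₁ basis outside outside≡0 s)))
    where
    inside outside : Fin m → Bool
    inside  s = D s ∧ does (inClass? a (v s))
    outside s = D s ∧ not (does (inClass? a (v s)))

    inside-inClass : ∀ s → inside s ≡ true → InClass a (v s)
    inside-inClass s h = does-sound (inClass? a (v s)) (proj₂ (∧≡true⇒ {D s} h))

    outside-outOfClass : ∀ s → outside s ≡ true → OutOfClass a (v s)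
    outside-outOfClass s h with ∧≡true⇒ h
    ... | Ds , ¬in with edges s (D⊆S s Ds)
    ...   | x , y , vs≡xy with linkedEdge-classes a (subst (spanOf v S) vs≡xy (v∈spanOf s (D⊆S s Ds)))
    ...     | inj₁ xy∈a = ⊥-elim (false≢true (trans (sym (not-injective ¬in))
                                                    (dec-true (inClass? a (v s)) (subst (InClass a) (sym vs≡xy) xy∈a))))
    ...     | inj₂ xy∉a = subst (OutOfClass a) (sym vs≡xy) xy∉a

    outside≡y⊕inside : lincomb outside v ≡ y ⊕ lincomb inside v
    outside≡y⊕inside = begin
      lincomb outside v                                         ≡⟨ sym (x⊕y⊕y≡x _ _) ⟩
      lincomb outside v ⊕ lincomb inside v ⊕ lincomb inside v   ≡⟨ cong (_⊕ lincomb inside v) (sym (lincomb-xor outside inside v)) ⟩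
      lincomb (λ s → outside s xor inside s) v ⊕ lincomb inside v
        ≡⟨ cong (_⊕ lincomb inside v) (lincomb-cong v (λ s → sym (∧-not-split (D s) (does (inClass? a (v s)))))) ⟩
      lincomb D v ⊕ lincomb inside v                            ≡⟨ cong (_⊕ lincomb inside v) (sym y≡) ⟩
      y ⊕ lincomb inside v                                      ∎

    outside≡0 : lincomb outside v ≡ 0ᵥ
    outside≡0 = ev-ext _ _ λ i → trans (vanishes i) (sym (ev-0 i))
      where
      vanishes : ∀ i → ev i (lincomb outside v) ≡ false
      vanishes i with Linked? a i
      ... | yes ai = ev-lincomb-false i outside v (λ s h → outside-outOfClass s h i ai)
      ... | no ¬ai = begin
        ev i (lincomb outside v)                  ≡⟨ cong (ev i) outside≡y⊕inside ⟩
        ev i (y ⊕ lincomb inside v)               ≡⟨ ev-linear i y _ ⟩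
        ev i y xor ev i (lincomb inside v)        ≡⟨ cong₂ _xor_ (y∈a i ¬ai) (ev-lincomb-false i inside v (λ s h → inside-inClass s h i ¬ai)) ⟩
        false                                     ∎

  module ThreeInside (edges : Edges) where

    private
      crossing-below : ∀ {T} → T ⊆ᵇ S → ∃[ t ] T t ≡ true → ∃[ w ] (S w ≡ true × T w ≡ false) →
        ∀ {P Q Y Z} → Distinct4 P Q Y Z → crosses P Q Y Z ≡ true →
        spanOf v T (edge P Q) → spanOf v T (edge Y Z) → Linked P Y
      crossing-below {T} T⊆S (t , Tt) (w , Sw , Tw) D cr PQ∈T YZ∈T =
        spanOf-mono T⊆S _ (link-crossing T ((t , Tt) , (w , Tw)) (inj₁ (T⊆S , w , Sw , Tw)) D cr PQ∈T YZ∈T)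

      module Crossing {a c b d} (D : Distinct4 a c b d) (cr : crosses a c b d ≡ true)
                      (ac : Linked a c) (bd : Linked b d) (¬ab : ¬ Linked a b)
                      {C₁ C₂} (C₁⊆S : C₁ ⊆ᵇ S) (ac≡ : edge a c ≡ lincomb C₁ v)
                      (C₂⊆S : C₂ ⊆ᵇ S) (bd≡ : edge b d ≡ lincomb C₂ v)
                      (cover : ∀ i → S i ≡ true → C₁ i ∨ C₂ i ≡ true) where

        C₂-inClass : ∀ i → C₂ i ≡ true → InClass b (v i)
        C₂-inClass = summands-inClass edges b C₂⊆S bd≡ (edge-inClass (linked-refl b) bd)

        disjoint-C₂ : ∀ {E : Fin m → Bool} → (∀ i → E i ≡ true → InClass a (v i)) → ∀ i → E i ≡ true → C₂ i ≡ false
        disjoint-C₂ E-inClass i Ei = ¬-not λ C₂i → ¬ab (inClass-disjoint (E-inClass i Ei) (C₂-inClass i C₂i) (v≢0 i))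

        -- Deleting the summands F of one half of a – c from S keeps a crossing inside a smaller vertex.
        without : ∀ {E F P Q} → E ⊆ᵇ S → F ⊆ᵇ S → (∀ i → E i ≡ true → F i ≡ false) →
          (∀ i → F i ≡ true → C₂ i ≡ false) → ∃[ i ] E i ≡ true → ∃[ i ] F i ≡ true →
          edge P Q ≡ lincomb E v → Distinct4 P Q b d → crosses P Q b d ≡ true → Linked P b
        without {E} {F} E⊆S F⊆S E∩F F∩C₂ (t , Et) (w , Fw) PQ≡ D′ cr′ =
          crossing-below T⊆S (t , E⊆T t Et) (w , F⊆S w Fw , trans (cong (λ z → S w ∧ not z) Fw) (∧-zeroʳ (S w))) D′ cr′
            (rep→span (E , E⊆T , PQ≡)) (rep→span (C₂ , C₂⊆T , bd≡))
          where
          T : Fin m → Bool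
          T i = S i ∧ not (F i)
          T⊆S : T ⊆ᵇ S
          T⊆S i h = proj₁ (∧≡true⇒ h)
          E⊆T : E ⊆ᵇ T
          E⊆T i Ei = cong₂ _∧_ (E⊆S i Ei) (cong not (E∩F i Ei))
          C₂⊆T : C₂ ⊆ᵇ T
          C₂⊆T i C₂i = cong₂ _∧_ (C₂⊆S i C₂i) (cong not (¬-not λ Fi → false≢true (trans (sym (F∩C₂ i Fi)) C₂i)))

        through : ∀ {x} → Linked a x → x ≢ a → x ≢ c → ⊥
        through {x} ax x≢a x≢c = halves D (span→rep ax) (span→rep xc)
          where
          xc : Linked x c
          xc = linked-trans (linked-sym ax) ac
          x≢b : x ≢ b
          x≢b x≡b = ¬ab (subst (Linked a) x≡b ax)
          x≢d : x ≢ d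
          x≢d x≡d = ¬ab (linked-trans (subst (Linked a) x≡d ax) (linked-sym bd))

          halves : Distinct4 a c b d → Rep v S (edge a x) → Rep v S (edge x c) → ⊥
          halves (_ , a≢b , a≢d , c≢b , c≢d , b≢d) (E₁ , E₁⊆S , ax≡) (E₂ , E₂⊆S , xc≡) = by-crossing (crosses a x b d) refl
            where
            E₁-inClass : ∀ i → E₁ i ≡ true → InClass a (v i)
            E₁-inClass = summands-inClass edges a E₁⊆S ax≡ (edge-inClass (linked-refl a) ax)
            E₂-inClass : ∀ i → E₂ i ≡ true → InClass a (v i)
            E₂-inClass = summands-inClass edges a E₂⊆S xc≡ (edge-inClass ax ac)
            E₁⊕E₂≡C₁ : ∀ i → E₁ i xor E₂ i ≡ C₁ i
            E₁⊕E₂≡C₁ = coefficients-unique _ _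
              (trans (lincomb-xor E₁ E₂ v) (trans (cong₂ _⊕_ (sym ax≡) (sym xc≡)) (trans (edge-trans a x c) ac≡)))
            E₁∩E₂ : ∀ i → E₁ i ≡ true → E₂ i ≡ false
            E₁∩E₂ i E₁i = ¬-not λ E₂i → false≢true (trans
              (sym (cong₂ _∨_ (trans (sym (E₁⊕E₂≡C₁ i)) (cong₂ _xor_ E₁i E₂i)) (disjoint-C₂ E₁-inClass i E₁i)))
              (cover i (E₁⊆S i E₁i)))
            E₂∩E₁ : ∀ i → E₂ i ≡ true → E₁ i ≡ false
            E₂∩E₁ i E₂i = ¬-not λ E₁i → false≢true (trans (sym (E₁∩E₂ i E₁i)) E₂i)
            ne₁ : ∃[ i ] E₁ i ≡ true
            ne₁ = lincomb-nonzero E₁ v λ E₁≡0 → x≢a (sym (edge≡0⇒≡ (trans ax≡ E₁≡0)))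
            ne₂ : ∃[ i ] E₂ i ≡ true
            ne₂ = lincomb-nonzero E₂ v λ E₂≡0 → x≢c (edge≡0⇒≡ (trans xc≡ E₂≡0))

            by-crossing : ∀ β → crosses a x b d ≡ β → ⊥
            by-crossing true  cr₁ = ¬ab (without E₁⊆S E₂⊆S E₁∩E₂ (disjoint-C₂ E₂-inClass) ne₁ ne₂ ax≡
                                          (≢-sym x≢a , a≢b , a≢d , x≢b , x≢d , b≢d) cr₁)
            by-crossing false cr₁ = ¬ab (linked-trans ax (without E₂⊆S E₁⊆S E₂∩E₁ (disjoint-C₂ E₁-inClass) ne₂ ne₁ xc≡
                                          (x≢c , x≢b , x≢d , c≢b , c≢d , b≢d) cr₂))
              where
              cr₂ : crosses x c b d ≡ true
              cr₂ = trans (cong (_xor crosses x c b d) (sym cr₁)) (trans (crosses-telescope a x c b d) cr)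

        two-in-C₁ : ∀ {s s′} → s ≢ s′ → C₁ s ≡ true → C₁ s′ ≡ true → ⊥
        two-in-C₁ {s} {s′} s≢s′ C₁s C₁s′ = endpoints (edges s (C₁⊆S s C₁s))
          where
          endpoints : IsEdge (v s) → ⊥
          endpoints (u , w , vs≡uw) = outside-endpoint (endpoint-outside u≢w uw≢ac)
            where
            u≢w : u ≢ w
            u≢w u≡w = v≢0 s (trans vs≡uw (trans (cong (edge u) (sym u≡w)) (edge-self u)))
            uw≢ac : edge u w ≢ edge a c
            uw≢ac uw≡ac = false≢true (begin
              false     ≡⟨ sym (δ-false s≢s′) ⟩
              δ s s′    ≡⟨ sym (coefficients-unique C₁ (δ s) C₁≡δs s′) ⟩
              C₁ s′     ≡⟨ C₁s′ ⟩
              true      ∎)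
              where
              C₁≡δs : lincomb C₁ v ≡ lincomb (δ s) v
              C₁≡δs = trans (sym ac≡) (trans (sym uw≡ac) (trans (sym vs≡uw) (sym (lincomb-δ s v))))
            vs∈a : InClass a (v s)
            vs∈a = summands-inClass edges a C₁⊆S ac≡ (edge-inClass (linked-refl a) ac) s C₁s
            outside-endpoint : (u ≢ a × u ≢ c) ⊎ (w ≢ a × w ≢ c) → ⊥
            outside-endpoint (inj₁ (u≢a , u≢c)) =
              through (inClass-endpoint (subst (InClass a) vs≡uw vs∈a) u≢w) u≢a u≢c
            outside-endpoint (inj₂ (w≢a , w≢c)) =
              through (inClass-endpoint (subst (InClass a) (trans vs≡uw (edge-sym u w)) vs∈a) (≢-sym u≢w)) w≢a w≢c

    links-noncrossing : ThreePoints S → LinksNoncrossing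
    links-noncrossing (s₁ , s₂ , s₃ , (S₁ , S₂ , S₃) , s₁≢s₂ , s₁≢s₃ , s₂≢s₃) a b c d a<b b<c c<d ac bd with Linked? a b
    ... | yes ab = ab
    ... | no ¬ab = ⊥-elim (broken (distinct-ordered a<b b<c c<d) (span→rep ac) (span→rep bd))
      where
      cr : crosses a c b d ≡ true
      cr = crosses-ordered a<b b<c c<d

      broken : Distinct4 a c b d → Rep v S (edge a c) → Rep v S (edge b d) → ⊥
      broken D@(a≢c , a≢b , a≢d , c≢b , c≢d , b≢d) (C₁ , C₁⊆S , ac≡) (C₂ , C₂⊆S , bd≡) with any? (λ i → S i ∧ not (C₁ i ∨ C₂ i) ≟ᵇ true)
      ... | yes (i , h) =
        ¬ab (crossing-below T⊆S T-ne (i , proj₁ (∧≡true⇒ h) , not-injective (proj₂ (∧≡true⇒ h))) D cr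
               (rep→span (C₁ , (λ j C₁j → cong (_∨ C₂ j) C₁j) , ac≡))
               (rep→span (C₂ , (λ j C₂j → trans (cong (C₁ j ∨_) C₂j) (∨-zeroʳ _)) , bd≡)))
        where
        T⊆S : (λ j → C₁ j ∨ C₂ j) ⊆ᵇ S
        T⊆S j h with ∨≡true⇒ h
        ... | inj₁ C₁j = C₁⊆S j C₁j
        ... | inj₂ C₂j = C₂⊆S j C₂j
        T-ne : ∃[ t ] C₁ t ∨ C₂ t ≡ true
        T-ne with lincomb-nonzero C₁ v (λ C₁≡0 → a≢c (edge≡0⇒≡ (trans ac≡ C₁≡0)))
        ... | t , C₁t = t , cong (_∨ C₂ t) C₁t
      ... | no none = pigeonhole (∨≡true⇒ (cover s₁ S₁)) (∨≡true⇒ (cover s₂ S₂)) (∨≡true⇒ (cover s₃ S₃))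
        where
        cover : ∀ i → S i ≡ true → C₁ i ∨ C₂ i ≡ true
        cover i Si = ¬-not λ C₁∨C₂≡false → none (i , cong₂ (λ x y → x ∧ not y) Si C₁∨C₂≡false)
        open Crossing D cr ac bd ¬ab C₁⊆S ac≡ C₂⊆S bd≡ cover using () renaming (two-in-C₁ to two-in-C₁)
        open Crossing (b≢d , ≢-sym a≢b , ≢-sym c≢b , ≢-sym a≢d , ≢-sym c≢d , a≢c) (trans (sym (crosses-sym D)) cr)
                      bd ac (λ ba → ¬ab (linked-sym ba)) C₂⊆S bd≡ C₁⊆S ac≡
                      (λ i Si → trans (∨-comm (C₂ i) (C₁ i)) (cover i Si)) using () renaming (two-in-C₁ to two-in-C₂)
        pigeonhole : C₁ s₁ ≡ true ⊎ C₂ s₁ ≡ true → C₁ s₂ ≡ true ⊎ C₂ s₂ ≡ true → C₁ s₃ ≡ true ⊎ C₂ s₃ ≡ true → ⊥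
        pigeonhole (inj₁ x) (inj₁ y) _        = two-in-C₁ s₁≢s₂ x y
        pigeonhole (inj₁ x) _        (inj₁ z) = two-in-C₁ s₁≢s₃ x z
        pigeonhole _        (inj₁ y) (inj₁ z) = two-in-C₁ s₂≢s₃ y z
        pigeonhole (inj₂ x) (inj₂ y) _        = two-in-C₂ s₁≢s₂ x y
        pigeonhole (inj₂ x) _        (inj₂ z) = two-in-C₂ s₁≢s₃ x z
        pigeonhole _        (inj₂ y) (inj₂ z) = two-in-C₂ s₂≢s₃ y z

vertexNCP-resp-≐ : ∀ {n} {P Q : SubsetV (pred n)} → P ≐ Q → VertexNCP n Q → VertexNCP n P
vertexNCP-resp-≐ (P⊆Q , Q⊆P) (((w , Qw , w≢0) , (u , ¬Qu)) , ρ , nc , Q⊆f , f⊆Q) =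
  ((w , Q⊆P w Qw , w≢0) , (u , λ Pu → ¬Qu (P⊆Q u Pu))) ,
  ρ , nc , (λ x Px → Q⊆f x (P⊆Q x Px)) , (λ x fx → Q⊆P x (f⊆Q x fx))

vertex-of-link : ∀ {k} {v : Fin (4 + k) → Vect (4 + k)} → IsBasis v →
  ∀ {p} → VertexA v p → LinkInNCP (5 + k) v p → VertexNCP (5 + k) p
vertex-of-link {k} {v} basis {p} (S , S-pne@((s₀ , Ss₀) , _) , p≐) linkInNCP =
  vertexNCP-resp-≐ p≐ (vertexNCP S-pne (proj₁ structure) (proj₂ structure))
  where
  open Link basis (link-vertex basis S-pne p≐ linkInNCP)

  structure : Edges × LinksNoncrossing
  structure with another-or-only S s₀
  ... | inj₂ only = Singleton.edges Ss₀ only (three-others s₀) , Singleton.links-noncrossing Ss₀ only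
  ... | inj₁ (s₁ , Ss₁ , s₀≢s₁) = edges , noncrossing (two-outside-or-not S)
    where
    edges : Edges
    edges = edges-nonsingleton λ s Ss → case (s ≟ᶠ s₀)
      where
      case : ∀ {s} → Dec (s ≡ s₀) → ∃[ s′ ] (S s′ ≡ true × s ≢ s′)
      case (yes refl)  = s₁ , Ss₁ , s₀≢s₁
      case (no  s≢s₀) = s₀ , Ss₀ , s≢s₀
    noncrossing : (∃[ t ] ∃[ t′ ] (t ≢ t′ × S t ≡ false × S t′ ≡ false)) ⊎
                  (∀ t t′ → S t ≡ false → S t′ ≡ false → t ≡ t′) → LinksNoncrossing
    noncrossing (inj₁ (t , t′ , t≢t′ , St , St′)) = TwoOutside.links-noncrossing t≢t′ St St′ (s₀ , Ss₀)
    noncrossing (inj₂ one-outside) = ThreeInside.links-noncrossing edges (three-inside S one-outside)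

-- The case n = 4

noncrossing? : ∀ {n} (π : Partition n) → Dec (NonCrossing π)
noncrossing? π = all? λ a → all? λ b → all? λ c → all? λ d →
  (a <?ᶠ b) →-dec ((b <?ᶠ c) →-dec ((c <?ᶠ d) →-dec ((π a ≟ᶠ π c) →-dec ((π b ≟ᶠ π d) →-dec (π a ≟ᶠ π b)))))

module Four where

  pt₁ pt₂ pt₃ pt₄ : Fin 4
  pt₁ = fz
  pt₂ = fs fz
  pt₃ = fs (fs fz)
  pt₄ = fs (fs (fs fz))

  -- e₁ + e₃, e₂ (= e₂ + e₄) and e₁ (= e₁ + e₄)
  w : Fin 3 → Vect 3
  w fz           = edge pt₁ pt₃
  w (fs fz)      = edge pt₂ pt₄
  w (fs (fs fz)) = edge pt₁ pt₄

  w-basis : IsBasis w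
  w-basis = independent , spanning
    where
    independent : LinIndep w
    independent c h with c fz in c₀ | c (fs fz) in c₁ | c (fs (fs fz)) in c₂
    independent c () | true  | true  | true
    independent c () | true  | true  | false
    independent c () | true  | false | true
    independent c () | true  | false | false
    independent c () | false | true  | true
    independent c () | false | true  | false
    independent c () | false | false | true
    independent c h  | false | false | false = λ { fz → c₀ ; (fs fz) → c₁ ; (fs (fs fz)) → c₂ }

    spanning : Spanning w
    spanning (false ∷ false ∷ false ∷ []) = span-0
    spanning (true  ∷ false ∷ false ∷ []) = span-add (fs (fs fz) , refl) span-0
    spanning (false ∷ true  ∷ false ∷ []) = span-add (fs fz , refl) span-0
    spanning (true  ∷ true  ∷ false ∷ []) = span-add (fs fz , refl) (span-add (fs (fs fz) , refl) span-0)
    spanning (true  ∷ false ∷ true  ∷ []) = span-add (fz , refl) span-0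
    spanning (false ∷ false ∷ true  ∷ []) = span-add (fz , refl) (span-add (fs (fs fz) , refl) span-0)
    spanning (true  ∷ true  ∷ true  ∷ []) = span-add (fz , refl) (span-add (fs fz , refl) span-0)
    spanning (false ∷ true  ∷ true  ∷ []) = span-add (fz , refl) (span-add (fs fz , refl) (span-add (fs (fs fz) , refl) span-0))

  open Basis w-basis

  S : Fin 3 → Bool
  S fz           = true
  S (fs fz)      = true
  S (fs (fs fz)) = false

  S-pne : ProperNonEmpty S
  S-pne = (fz , refl) , (fs (fs fz) , refl)

  -- spanOf w S contains e₁ + e₃ and e₂ + e₄, whose pairs cross
  not-vertex : ¬ VertexNCP 4 (spanOf w S)
  not-vertex (_ , π , nc , p⊆f , f⊆p) = v∉spanOf (fs (fs fz)) refl w₂∈p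
    where
    π₀≡π₂ : π pt₁ ≡ π pt₃
    π₀≡π₂ = edge∈f⇒sameBlock π pt₁ pt₃ (p⊆f _ (v∈spanOf fz refl))
    π₁≡π₃ : π pt₂ ≡ π pt₄
    π₁≡π₃ = edge∈f⇒sameBlock π pt₂ pt₄ (p⊆f _ (v∈spanOf (fs fz) refl))
    π₀≡π₁ : π pt₁ ≡ π pt₂
    π₀≡π₁ = nc pt₁ pt₂ pt₃ pt₄ (s≤s z≤n) (s≤s (s≤s z≤n)) (s≤s (s≤s (s≤s z≤n))) π₀≡π₂ π₁≡π₃
    w₂∈p : spanOf w S (w (fs (fs fz)))
    w₂∈p = spanOf-isSubspace w S .⊕∈ (f⊆p _ (sameBlock⇒edge∈f π pt₁ pt₂ π₀≡π₁)) (v∈spanOf (fs fz) refl)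

  sameBlock-edges? : ∀ (π : Partition 4) x → Dec (∀ i j → π i ≡ π j → Pair x (edge i j))
  sameBlock-edges? π x = all? λ i → all? λ j → (π i ≟ᶠ π j) →-dec pair? x (edge i j)

  line-vertex : ∀ {T} {Q : SubsetV 3} s (π : Partition 4) → NonCrossing π →
    (∀ i j → π i ≡ π j → Pair (w s) (edge i j)) → f π (w s) →
    (∀ i → T i ≡ true → i ≡ s) → T s ≡ true → ∃[ t ] T t ≡ false → Q ≐ spanOf w T → VertexNCP 4 Q
  line-vertex {T} s π nc sameBlock-edges ws∈f only Ts (t , Tt) (Q⊆T , T⊆Q) =
    ((w s , T⊆Q _ (v∈spanOf s Ts) , v≢0 s) , (w t , λ Qwt → v∉spanOf t Tt (Q⊆T _ Qwt))) ,
    π , nc , (λ x Qx → pair⊆f x (T⊆pair x (Q⊆T x Qx))) , (λ x fx → T⊆Q x (pair⊆T x (f⊆pair x fx)))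
    where
    T⊆pair : spanOf w T ⊆ᵥ Pair (w s)
    T⊆pair x h = spanOf-δ w s x (spanOf-mono (λ i Ti → subst (λ z → δ s z ≡ true) (sym (only i Ti)) (δ-refl s)) x h)
    f⊆pair : f π ⊆ᵥ Pair (w s)
    f⊆pair = span-least (pair-isSubspace (w s)) λ { _ (i , j , πi≡πj , refl) → sameBlock-edges i j πi≡πj }
    pair⊆f : Pair (w s) ⊆ᵥ f π
    pair⊆f _ (inj₁ refl) = span-0
    pair⊆f _ (inj₂ refl) = ws∈f
    pair⊆T : Pair (w s) ⊆ᵥ spanOf w T
    pair⊆T _ (inj₁ refl) = span-0
    pair⊆T _ (inj₂ refl) = v∈spanOf s Ts

  π₁₃ : Partition 4
  π₁₃ fz                = pt₁
  π₁₃ (fs fz)           = pt₂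
  π₁₃ (fs (fs fz))      = pt₁
  π₁₃ (fs (fs (fs fz))) = pt₄

  π₂₄ : Partition 4
  π₂₄ fz                = pt₁
  π₂₄ (fs fz)           = pt₂
  π₂₄ (fs (fs fz))      = pt₃
  π₂₄ (fs (fs (fs fz))) = pt₂

  incomparable : ∀ {T Q} j → T j ≡ false → S j ≡ true → T (fs (fs fz)) ≡ true → Q ≐ spanOf w T →
    (spanOf w S ⊆ᵥ Q) ⊎ (Q ⊆ᵥ spanOf w S) → ⊥
  incomparable j Tj Sj T₂ (Q⊆T , T⊆Q) (inj₁ p⊆Q) = v∉spanOf j Tj (Q⊆T _ (p⊆Q _ (v∈spanOf j Sj)))
  incomparable j Tj Sj T₂ (Q⊆T , T⊆Q) (inj₂ Q⊆p) = v∉spanOf (fs (fs fz)) refl (Q⊆p _ (T⊆Q _ (v∈spanOf (fs (fs fz)) T₂)))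

  link-vertexNCP : ∀ {Q} T → ProperNonEmpty T → Q ≐ spanOf w T → ¬ Q ≐ spanOf w S →
    (spanOf w S ⊆ᵥ Q) ⊎ (Q ⊆ᵥ spanOf w S) → VertexNCP 4 Q
  link-vertexNCP T ((i , Ti) , (j , Tj)) Q≐ Q≉p comparable
    with T fz in T₀ | T (fs fz) in T₁ | T (fs (fs fz)) in T₂
  ... | true  | true  | true  = ⊥-elim (false≢true (trans (sym Tj) (all-true j)))
    where
    all-true : ∀ i → T i ≡ true
    all-true fz = T₀
    all-true (fs fz) = T₁
    all-true (fs (fs fz)) = T₂
  ... | false | false | false = ⊥-elim (false≢true (trans (sym (all-false i)) Ti))
    where
    all-false : ∀ i → T i ≡ false
    all-false fz = T₀
    all-false (fs fz) = T₁
    all-false (fs (fs fz)) = T₂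
  ... | true  | true  | false = ⊥-elim (Q≉p ((λ x h → spanOf-mono T⊆S x (proj₁ Q≐ x h)) , (λ x h → proj₂ Q≐ x (spanOf-mono S⊆T x h))))
    where
    T⊆S : T ⊆ᵇ S
    T⊆S fz _ = refl
    T⊆S (fs fz) _ = refl
    T⊆S (fs (fs fz)) h = ⊥-elim (false≢true (trans (sym T₂) h))
    S⊆T : S ⊆ᵇ T
    S⊆T fz _ = T₀
    S⊆T (fs fz) _ = T₁
    S⊆T (fs (fs fz)) ()
  ... | true  | false | false = line-vertex fz π₁₃ (toWitness {a? = noncrossing? π₁₃} _)
                                  (toWitness {a? = sameBlock-edges? π₁₃ (w fz)} _) (span-gen (pt₁ , pt₃ , refl , refl))
                                  only T₀ (fs fz , T₁) Q≐
    where
    only : ∀ i → T i ≡ true → i ≡ fz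
    only fz _ = refl
    only (fs fz) h = ⊥-elim (false≢true (trans (sym T₁) h))
    only (fs (fs fz)) h = ⊥-elim (false≢true (trans (sym T₂) h))
  ... | false | true  | false = line-vertex (fs fz) π₂₄ (toWitness {a? = noncrossing? π₂₄} _)
                                  (toWitness {a? = sameBlock-edges? π₂₄ (w (fs fz))} _) (span-gen (pt₂ , pt₄ , refl , refl))
                                  only T₁ (fz , T₀) Q≐
    where
    only : ∀ i → T i ≡ true → i ≡ fs fz
    only fz h = ⊥-elim (false≢true (trans (sym T₀) h))
    only (fs fz) _ = refl
    only (fs (fs fz)) h = ⊥-elim (false≢true (trans (sym T₂) h))
  ... | false | _     | true  = ⊥-elim (incomparable fz T₀ refl T₂ Q≐ comparable)
  ... | true  | false | true  = ⊥-elim (incomparable (fs fz) T₁ refl T₂ Q≐ comparable)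

  link : LinkInNCP 4 w (spanOf w S)
  link σ ((vertices , chain) , p∉σ , (_ , chain-p)) = All.tabulate vertexNCP , chain
    where
    vertexNCP : ∀ {Q} → Any (Q ≡_) σ → VertexNCP 4 Q
    vertexNCP {Q} Q∈σ with All.lookup vertices Q∈σ
    ... | T , T-pne , Q≐ = link-vertexNCP T T-pne Q≐ (λ Q≐p → p∉σ (Any.map (λ { refl → Q≐p }) Q∈σ))
                                            (chain-p (here refl) (there Q∈σ))

  counterexample : ∃[ v ] ∃[ p ] (IsBasis {pred 4} v × VertexA v p × LinkInNCP 4 v p × ¬ VertexNCP 4 p)
  counterexample = w , spanOf w S , w-basis , (S , S-pne , (λ _ h → h) , (λ _ h → h)) , link , not-vertex

mainTheorem9 : ((n : ℕ) → 5 ≤ n →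
    (v : Fin (pred n) → Vect (pred n)) → IsBasis v →
    (p : SubsetV (pred n)) → VertexA v p →
    LinkInNCP n v p → VertexNCP n p)
    × (∃[ v ] ∃[ p ] (IsBasis {pred 4} v × VertexA v p × LinkInNCP 4 v p × ¬ VertexNCP 4 p))
mainTheorem9 = (λ { _ (s≤s (s≤s (s≤s (s≤s (s≤s z≤n))))) v basis p vertex link → vertex-of-link basis vertex link })
             , Four.counterexample
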